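{- Fix integers $k,l\ge 0$ with $k+l>0$ and $n\ge1$, let $v\in a_{k,l}(n)$ and $A,B\in I(k,l)$. For each of the four variants $(\epsilon,\delta)\in\{\text{regular},\text{dual}\}^2$: if $v\mapsto (P^*_A,Q^*_A)$ under the $(\epsilon,\delta)$-$A$-RSK and $v\mapsto (P^*_B,Q^*_B)$ under the $(\epsilon,\delta)$-$B$-RSK, then $\mathrm{sh}(P^*_A)=\mathrm{sh}(P^*_B)$, and consequently $Q^*_A=Q^*_B$. (Part (a): (regular, regular); (b): (regular, dual); (c): (dual, regular); (d): (dual, dual).)
   Context: Let $t_1,\dots,t_k,u_1,\dots,u_l$ be distinct symbols ("$t$-letters" and "$u$-letters"). A shuffle is a total order $<_A$ on $\{t_1,\dots,t_k,u_1,\dots,u_l\}$ with $t_1<_A\cdots<_A t_k$ and $u_1<_A\cdots<_A u_l$; $I(k,l)$ is the set of shuffles. $a_{k,l}(n)$ is the set of words $v_1\cdots v_n$ in these letters. Tableaux are fillings of Young diagrams (English convention), $c(i,j)$ the cell in row $i$, column $j$. The $(\epsilon,\delta)$-$A$-RSK insertion of a letter $x$ proceeds in steps, each inserting a letter $y$ into a row or column: initially $x$ is inserted into row 1 if it is a $t$-letter, into column 1 if it is a $u$-letter. Inserting a $t$-letter $y$ into row $r$: if $\epsilon=$ regular (resp. dual), $y$ bumps the leftmost entry of row $r$ that is strictly $A$-greater than $y$ (resp. $A$-greater than or equal to $y$); if there is none, $y$ is placed in a new cell at the end of row $r$. Inserting a $u$-letter $y$ into column $c$: if $\delta=$ regular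 (resp. dual), $y$ bumps the topmost entry of column $c$ strictly $A$-greater than $y$ (resp. $A$-greater than or equal to $y$); if none, $y$ is placed in a new cell at the bottom of column $c$. An entry bumped from $c(i,j)$ is next inserted into row $i+1$ if it is a $t$-letter, into column $j+1$ if it is a $u$-letter; insertion ends when a new cell is created. The insertion tableau $P^*_A$ of $v$ is obtained by inserting $v_1,\dots,v_n$ successively into the empty tableau, and the recording tableau $Q^*_A$ is the standard Young tableau of the same shape with entry $m$ in the cell created while inserting $v_m$. -}

module Defs where

open import Data.Nat using (ℕ; zero; suc; _<_; _≤_; _+_)
import Data.Nat
open import Data.Fin using (Fin)
import Data.Fin as F
open import Data.Maybe using (Maybe; just; nothing)
open import Data.Product using (Σ; _×_; _,_)
open import Data.List using (List; []; _∷_)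
open import Relation.Nullary using (¬_)
open import Relation.Binary.PropositionalEquality using (_≡_)
open import Function.Definitions using (Injective)

data Letter (k l : ℕ) : Set where
  t : Fin k → Letter k l
  u : Fin l → Letter k l

-- A shuffle A ∈ I(k,l): a total order on the letters, encoded by an
-- injective rank function (x <_A y iff rank x < rank y), such that
-- t_1 <_A ... <_A t_k and u_1 <_A ... <_A u_l.
record Shuffle (k l : ℕ) : Set where
  field
    rank   : Letter k l → ℕ
    rank-injective : Injective _≡_ _≡_ rank
    t-increasing : ∀ {i j : Fin k} → i F.< j → rank (t i) < rank (t j)
    u-increasing : ∀ {i j : Fin l} → i F.< j → rank (u i) < rank (u j)
open Shuffle public

_<[_]_ : ∀ {k l} → Letter k l → Shuffle k l → Letter k l → Set
x <[ A ] y = rank A x < rank A y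

_≤[_]_ : ∀ {k l} → Letter k l → Shuffle k l → Letter k l → Set
x ≤[ A ] y = rank A x ≤ rank A y

data Variant : Set where
  regular dual : Variant

Bumps : ∀ {k l} → Variant → Shuffle k l → Letter k l → Letter k l → Set
Bumps regular A y z = y <[ A ] z
Bumps dual    A y z = y ≤[ A ] z

-- Tableaux: a filling T i j (row i, column j; 0-indexed, English convention);
-- nothing = no cell.
Tableau : ℕ → ℕ → Set
Tableau k l = ℕ → ℕ → Maybe (Letter k l)

emptyT : ∀ {k l} → Tableau k l
emptyT _ _ = nothing

RecTableau : Set
RecTableau = ℕ → ℕ → Maybe ℕ

emptyQ : RecTableau
emptyQ _ _ = nothing

update : ∀ {A : Set} → (ℕ → ℕ → Maybe A) → ℕ → ℕ → A → (ℕ → ℕ → Maybe A)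
update T i j x i' j' with i Data.Nat.≟ i' | j Data.Nat.≟ j'
... | Relation.Nullary.yes _ | Relation.Nullary.yes _ = just x
... | _ | _ = T i' j'

Cell : Set
Cell = ℕ × ℕ

-- An entry bumped from cell (i , j) is next inserted into row i+1 if it is a
-- t-letter, into column j+1 if it is a u-letter.
nextIndex : ∀ {k l} → Letter k l → ℕ → ℕ → ℕ
nextIndex (t _) i j = suc i
nextIndex (u _) i j = suc j

module Insertion {k l : ℕ} (ε δ : Variant) (A : Shuffle k l) where

  RowBefore : Tableau k l → ℕ → ℕ → Letter k l → Set
  RowBefore T r j y = ∀ j' → j' < j → Σ (Letter k l) λ z → (T r j' ≡ just z) × ¬ Bumps ε A y z

  ColBefore : Tableau k l → ℕ → ℕ → Letter k l → Set
  ColBefore T c i y = ∀ i' → i' < i → Σ (Letter k l) λ z → (T i' c ≡ just z) × ¬ Bumps δ A y z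

  -- Ins T m x T' c : inserting the letter x into row m (if x is a t-letter)
  -- resp. column m (if x is a u-letter) of T, including all subsequent
  -- bumps, ends with the tableau T' and the newly created cell c.
  data Ins : Tableau k l → ℕ → Letter k l → Tableau k l → Cell → Set where
    rowBump : ∀ {T r j a z T' c} →
      RowBefore T r j (t a) → T r j ≡ just z → Bumps ε A (t a) z →
      Ins (update T r j (t a)) (nextIndex z r j) z T' c →
      Ins T r (t a) T' c
    rowNew : ∀ {T r j a} →
      RowBefore T r j (t a) → T r j ≡ nothing →
      Ins T r (t a) (update T r j (t a)) (r , j)
    colBump : ∀ {T c i a z T' cell} →
      ColBefore T c i (u a) → T i c ≡ just z → Bumps δ A (u a) z →
      Ins (update T i c (u a)) (nextIndex z i c) z T' cell →
      Ins T c (u a) T' cell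
    colNew : ∀ {T c i a} →
      ColBefore T c i (u a) → T i c ≡ nothing →
      Ins T c (u a) (update T i c (u a)) (i , c)

  -- Inserting a letter into the tableau: t-letters into row 1, u-letters into
  -- column 1 (index 0 in both cases).
  Insert : Tableau k l → Letter k l → Tableau k l → Cell → Set
  Insert T x T' c = Ins T 0 x T' c

  -- Steps m P Q w P' Q': having inserted m letters giving (P , Q), inserting
  -- the letters of w successively yields (P' , Q'); the cell created while
  -- inserting the (m+1)-st letter receives entry m+1 in the recording tableau.
  data Steps : ℕ → Tableau k l → RecTableau → List (Letter k l) → Tableau k l → RecTableau → Set where
    done : ∀ {m P Q} → Steps m P Q [] P Q
    step : ∀ {m P Q x xs P₁ i j P' Q'} →
      Insert P x P₁ (i , j) →
      Steps (suc m) P₁ (update Q i j (suc m)) xs P' Q' →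
      Steps m P Q (x ∷ xs) P' Q'

  RSK : List (Letter k l) → Tableau k l → RecTableau → Set
  RSK v P Q = Steps 0 emptyT emptyQ v P Q

_↦[_,_,_]_,_ : ∀ {k l} → List (Letter k l) → Variant → Variant → Shuffle k l → Tableau k l → RecTableau → Set
v ↦[ ε , δ , A ] P , Q = Insertion.RSK ε δ A v P Q

data IsCell {A : Set} : Maybe A → Set where
  isCell : ∀ {x} → IsCell (just x)

SameShape : ∀ {k l} → Tableau k l → Tableau k l → Set
SameShape P P' = ∀ i j → (IsCell (P i j) → IsCell (P' i j)) × (IsCell (P' i j) → IsCell (P i j))

-- Replace every letter of v by its position.  Ranking positions by their letter in A and breaking
-- ties between copies of one letter left to right (regular variant) or right to left (dual
-- variant) turns the (ε,δ)-A-RSK into an insertion of distinct letters under a strict total order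
-- κ_A, with the same recording tableau and the same cells.  For distinct letters, exchanging two
-- neighbours x < y of the order, x a t-letter and y a u-letter, does not change the recording
-- tableau: the two insertions can be run side by side, their tableaux either equal or differing
-- only by x and y exchanged in adjacent cells of a line.  Since a shuffle only interleaves the
-- t-letters with the u-letters, such exchanges lead from κ_A to the order listing all u-letters
-- first, which does not depend on A.  Insertion is deterministic, so Q_A = Q_B, and the shape of
-- P is the set of cells of Q.

module Submission where

open import Defs
open import Data.Nat using (ℕ; zero; suc; _+_; _*_; _∸_; _<_; _≤_; _>_; z≤n; s≤s; z<s; _<?_)
open import Data.Nat.Properties
open import Data.Fin as F using (Fin; toℕ)
import Data.Fin.Properties as FP
open import Data.Fin.Permutation.Components using (transpose; transpose-inverse)
open import Data.List as List using (List; []; _∷_; allFin)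
open import Data.List.Properties using (∷-injective; map-tabulate)
open import Data.List.Membership.Propositional using (_∈_)
open import Data.List.Membership.Propositional.Properties using (∈-allFin)
open import Data.List.Relation.Unary.Any using (here; there)
open import Data.List.Relation.Unary.All as All using (All)
open import Data.List.Relation.Unary.AllPairs using (AllPairs; _∷_)
open import Data.List.Relation.Unary.AllPairs.Properties using (tabulate⁺-<)
open import Data.List.Relation.Unary.Unique.Propositional using (Unique)
open import Data.List.Relation.Unary.Unique.Propositional.Properties using (allFin⁺)
open import Data.Maybe as Maybe using (Maybe; just; nothing; is-just)
open import Data.Maybe.Properties using (just-injective; ≡-dec)
open import Data.Vec using (Vec; toList; lookup; []; _∷_)
open import Data.Product using (Σ; _×_; _,_; proj₁; proj₂)
open import Data.Sum using (_⊎_; inj₁; inj₂)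
open import Data.Empty using (⊥; ⊥-elim)
open import Data.Unit using (⊤; tt)
open import Function using (id)
open import Relation.Nullary using (¬_; Dec; yes; no)
open import Relation.Nullary.Decidable using (_×-dec_; dec-true; dec-false)
open import Relation.Binary.Definitions using (DecidableEquality; Tri; tri<; tri≈; tri>)
open import Relation.Binary.PropositionalEquality using (_≡_; refl; sym; trans; cong; cong₂; subst; subst₂; _≢_)

-- Cells and tableaux

data Kind : Set where
  tk uk : Kind

other : Kind → Kind
other tk = uk
other uk = tk

other-≢ : ∀ k → other k ≢ k
other-≢ tk ()
other-≢ uk ()

same-or-other : ∀ k k₂ → (k₂ ≡ k) ⊎ (k₂ ≡ other k)
same-or-other tk tk = inj₁ refl
same-or-other tk uk = inj₂ refl
same-or-other uk tk = inj₂ refl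
same-or-other uk uk = inj₁ refl

_≟ᴷ_ : (a b : Kind) → Dec (a ≡ b)
tk ≟ᴷ tk = yes refl
tk ≟ᴷ uk = no (λ ())
uk ≟ᴷ tk = no (λ ())
uk ≟ᴷ uk = yes refl

tk≢uk : tk ≢ uk
tk≢uk ()

tk-or-uk : ∀ k → (k ≡ tk) ⊎ (k ≡ uk)
tk-or-uk tk = inj₁ refl
tk-or-uk uk = inj₂ refl

-- A t-letter travels along rows and a u-letter along columns: cell k ℓ p is
-- position p of line ℓ, where lines are rows for tk and columns for uk.
cell : Kind → ℕ → ℕ → Cell
cell tk ℓ p = ℓ , p
cell uk ℓ p = p , ℓ

lineOf : Kind → Cell → ℕ
lineOf tk c = proj₁ c
lineOf uk c = proj₂ c

posOf : Kind → Cell → ℕ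
posOf tk c = proj₂ c
posOf uk c = proj₁ c

cell-other : ∀ k a b → cell (other k) a b ≡ cell k b a
cell-other tk a b = refl
cell-other uk a b = refl

cell-lineOf-posOf : ∀ k c → cell k (lineOf k c) (posOf k c) ≡ c
cell-lineOf-posOf tk c = refl
cell-lineOf-posOf uk c = refl

lineOf-cell : ∀ k a b → lineOf k (cell k a b) ≡ a
lineOf-cell tk a b = refl
lineOf-cell uk a b = refl

posOf-cell : ∀ k a b → posOf k (cell k a b) ≡ b
posOf-cell tk a b = refl
posOf-cell uk a b = refl

lineOf-other-cell : ∀ k a b → lineOf (other k) (cell k a b) ≡ b
lineOf-other-cell tk a b = refl
lineOf-other-cell uk a b = refl

posOf-other-cell : ∀ k a b → posOf (other k) (cell k a b) ≡ a
posOf-other-cell tk a b = refl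
posOf-other-cell uk a b = refl

cell-injective : ∀ k {a b a₂ b₂} → cell k a b ≡ cell k a₂ b₂ → (a ≡ a₂) × (b ≡ b₂)
cell-injective tk refl = refl , refl
cell-injective uk refl = refl , refl

_≟ᶜ_ : (c d : Cell) → Dec (c ≡ d)
(i , j) ≟ᶜ (i₂ , j₂) with i ≟ i₂ | j ≟ j₂
... | yes refl | yes refl = yes refl
... | no i≢i₂  | _        = no (λ eq → i≢i₂ (cong proj₁ eq))
... | yes _    | no j≢j₂  = no (λ eq → j≢j₂ (cong proj₂ eq))

Tab : Set → Set
Tab L = ℕ → ℕ → Maybe L

emptyTab : ∀ {L} → Tab L
emptyTab _ _ = nothing

at : ∀ {L} → Tab L → Cell → Maybe L
at T c = T (proj₁ c) (proj₂ c)

upd : ∀ {L} → Tab L → Cell → L → Tab L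
upd T c w = update T (proj₁ c) (proj₂ c) w

at-upd-≡ : ∀ {L} (T : Tab L) c w → at (upd T c w) c ≡ just w
at-upd-≡ T (i , j) w with i ≟ i | j ≟ j
... | yes _   | yes _   = refl
... | no i≢i  | _       = ⊥-elim (i≢i refl)
... | yes _   | no j≢j  = ⊥-elim (j≢j refl)

at-upd-≢ : ∀ {L} (T : Tab L) c w {d} → d ≢ c → at (upd T c w) d ≡ at T d
at-upd-≢ T (i , j) w {i₂ , j₂} d≢c with i ≟ i₂ | j ≟ j₂
... | yes refl | yes refl = ⊥-elim (d≢c refl)
... | no _     | _        = refl
... | yes _    | no _     = refl

at-upd-≡′ : ∀ {L} (T : Tab L) c w {d} → d ≡ c → at (upd T c w) d ≡ just w
at-upd-≡′ T c w refl = at-upd-≡ T c w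

≡just-unique : ∀ {L : Set} {a b : L} {m : Maybe L} → m ≡ just a → m ≡ just b → a ≡ b
≡just-unique e₁ e₂ = just-injective (trans (sym e₁) e₂)

_≈_ : ∀ {L} → Tab L → Tab L → Set
T ≈ U = ∀ c → at U c ≡ at T c

upd-≈ : ∀ {L} {T U : Tab L} c w → T ≈ U → upd T c w ≈ upd U c w
upd-≈ {T = T} {U} c w T≈U d with d ≟ᶜ c
... | yes refl = trans (at-upd-≡ U c w) (sym (at-upd-≡ T c w))
... | no d≢c   = trans (at-upd-≢ U c w d≢c) (trans (T≈U d) (sym (at-upd-≢ T c w d≢c)))

SameCells : ∀ {L M} → Tab L → Tab M → Set
SameCells T U = ∀ c → is-just (at T c) ≡ is-just (at U c)

upd-sameCells : ∀ {L M} {T : Tab L} {U : Tab M} c a b → SameCells T U → SameCells (upd T c a) (upd U c b)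
upd-sameCells {T = T} {U} c a b same d with d ≟ᶜ c
... | yes refl = trans (cong is-just (at-upd-≡ T c a)) (sym (cong is-just (at-upd-≡ U c b)))
... | no d≢c   = trans (cong is-just (at-upd-≢ T c a d≢c)) (trans (same d) (sym (cong is-just (at-upd-≢ U c b d≢c))))

upd-filled : ∀ {L} {T : Tab L} {c z} w → at T c ≡ just z → SameCells (upd T c w) T
upd-filled {T = T} {c} w atz d with d ≟ᶜ c
... | yes refl = trans (cong is-just (at-upd-≡ T c w)) (sym (cong is-just atz))
... | no d≢c   = cong is-just (at-upd-≢ T c w d≢c)

at-upd-just : ∀ {L} (T : Tab L) c w {d a} → at (upd T c w) d ≡ just a → (d ≡ c × a ≡ w) ⊎ (d ≢ c × at T d ≡ just a)
at-upd-just T c w {d} e with d ≟ᶜ c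
... | yes refl = inj₁ (refl , just-injective (trans (sym e) (at-upd-≡ T c w)))
... | no d≢c   = inj₂ (d≢c , trans (sym (at-upd-≢ T c w d≢c)) e)

-- Insertion over an arbitrary alphabet

module Scanning {L : Set} (Bump : Kind → L → L → Set) where

  record Before (T : Tab L) (k : Kind) (ℓ p : ℕ) (w : L) : Set where
    constructor mkBefore
    field passed : ∀ q → q < p → Σ L λ e → (at T (cell k ℓ q) ≡ just e) × ¬ Bump k w e
  open Before public

  data Stop (T : Tab L) (k : Kind) (ℓ p : ℕ) (w : L) : Set where
    blocked : ∀ {z} → at T (cell k ℓ p) ≡ just z → Bump k w z → Stop T k ℓ p w
    vacant  : at T (cell k ℓ p) ≡ nothing → Stop T k ℓ p w

  Before-Stop-< : ∀ {T k ℓ a b w} → Before T k ℓ b w → Stop T k ℓ a w → a < b → ⊥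
  Before-Stop-< {a = a} before stop a<b with passed before a a<b | stop
  ... | e , ate , ¬bump | blocked atz bumps with trans (sym atz) ate
  ...   | refl = ¬bump bumps
  Before-Stop-< {a = a} before stop a<b | e , ate , ¬bump | vacant nothing≡ with trans (sym nothing≡) ate
  ...   | ()

  scan-unique : ∀ {T k ℓ p p₂ w} → Before T k ℓ p w → Before T k ℓ p₂ w →
                Stop T k ℓ p w → Stop T k ℓ p₂ w → p ≡ p₂
  scan-unique {p = p} {p₂} before before₂ stop stop₂ with <-cmp p p₂
  ... | tri< p<p₂ _ _ = ⊥-elim (Before-Stop-< before₂ stop p<p₂)
  ... | tri≈ _ p≡p₂ _ = p≡p₂
  ... | tri> _ _ p₂<p = ⊥-elim (Before-Stop-< before stop₂ p₂<p)

module GenericInsertion {L : Set} (kind : L → Kind) (Bump : Kind → L → L → Set) where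

  open Scanning Bump public

  -- As Insertion.Ins of Defs, for any alphabet whose letters have a kind and are compared by a
  -- kind-dependent bump relation: Ins T ℓ w T₂ c inserts w into line ℓ of its own direction.
  data Ins : Tab L → ℕ → L → Tab L → Cell → Set where
    bump : ∀ {T ℓ w k p z T₂ c} → kind w ≡ k → Before T k ℓ p w → at T (cell k ℓ p) ≡ just z → Bump k w z →
           Ins (upd T (cell k ℓ p) w) (suc (lineOf (kind z) (cell k ℓ p))) z T₂ c → Ins T ℓ w T₂ c
    new  : ∀ {T ℓ w k p} → kind w ≡ k → Before T k ℓ p w → at T (cell k ℓ p) ≡ nothing →
           Ins T ℓ w (upd T (cell k ℓ p) w) (cell k ℓ p)

  data Steps : ℕ → Tab L → RecTableau → List L → Tab L → RecTableau → Set where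
    done : ∀ {m P Q} → Steps m P Q [] P Q
    step : ∀ {m P Q x xs P₁ c P₂ Q₂} → Ins P 0 x P₁ c →
           Steps (suc m) P₁ (upd Q c (suc m)) xs P₂ Q₂ → Steps m P Q (x ∷ xs) P₂ Q₂

  ins-deterministic : ∀ {T ℓ w T₁ c T₂ c₂} → Ins T ℓ w T₁ c → Ins T ℓ w T₂ c₂ → (c ≡ c₂) × (T₁ ≡ T₂)
  ins-deterministic (bump refl before atz bumps D) (bump refl before₂ atz₂ bumps₂ D₂)
    with scan-unique before before₂ (blocked atz bumps) (blocked atz₂ bumps₂)
  ... | refl with just-injective (trans (sym atz) atz₂)
  ...   | refl = ins-deterministic D D₂
  ins-deterministic (bump refl before atz bumps D) (new refl before₂ empty₂)
    with scan-unique before before₂ (blocked atz bumps) (vacant empty₂)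
  ... | refl with trans (sym atz) empty₂
  ...   | ()
  ins-deterministic (new refl before empty) (bump refl before₂ atz₂ bumps₂ D₂)
    with scan-unique before before₂ (vacant empty) (blocked atz₂ bumps₂)
  ... | refl with trans (sym empty) atz₂
  ...   | ()
  ins-deterministic (new refl before empty) (new refl before₂ empty₂)
    with scan-unique before before₂ (vacant empty) (vacant empty₂)
  ... | refl = refl , refl

  steps-deterministic : ∀ {m P Q ws P₁ Q₁ P₂ Q₂} → Steps m P Q ws P₁ Q₁ → Steps m P Q ws P₂ Q₂ → Q₁ ≡ Q₂
  steps-deterministic done done = refl
  steps-deterministic (step I S) (step I₂ S₂) with ins-deterministic I I₂
  ... | refl , refl = steps-deterministic S S₂

  ins-sameCells : ∀ {T ℓ w T₂ c} → Ins T ℓ w T₂ c → SameCells T₂ (upd T c w)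
  ins-sameCells {w = w} {c = c} (bump {z = z} _ _ atz _ D) d =
    trans (ins-sameCells D d) (upd-sameCells c z w (upd-filled w atz) d)
  ins-sameCells (new _ _ _) d = refl

  steps-sameCells : ∀ {m P Q ws P₂ Q₂} → Steps m P Q ws P₂ Q₂ → SameCells P Q → SameCells P₂ Q₂
  steps-sameCells done same = same
  steps-sameCells {m} (step {x = x} {c = c} I S) same =
    steps-sameCells S (λ d → trans (ins-sameCells I d) (upd-sameCells c x (suc m) same d))

module _ {L : Set} (kind : L → Kind) {Bump Bump₂ : Kind → L → L → Set}
         (to : ∀ k a b → Bump k a b → Bump₂ k a b) (from : ∀ k a b → Bump₂ k a b → Bump k a b) where
  private
    module I = GenericInsertion kind Bump
    module I₂ = GenericInsertion kind Bump₂

  Before-transport : ∀ {T k ℓ p w} → I.Before T k ℓ p w → I₂.Before T k ℓ p w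
  Before-transport {k = k} {w = w} before = I₂.mkBefore λ q q<p →
    let e , ate , ¬bump = I.passed before q q<p in e , ate , λ bumps → ¬bump (from k w e bumps)

  Ins-transport : ∀ {T ℓ w T₂ c} → I.Ins T ℓ w T₂ c → I₂.Ins T ℓ w T₂ c
  Ins-transport (I.bump {w = w} {k = k} {z = z} k≡ before atz bumps D) =
    I₂.bump k≡ (Before-transport before) atz (to k w z bumps) (Ins-transport D)
  Ins-transport (I.new k≡ before empty) = I₂.new k≡ (Before-transport before) empty

  Steps-transport : ∀ {m P Q ws P₂ Q₂} → I.Steps m P Q ws P₂ Q₂ → I₂.Steps m P Q ws P₂ Q₂
  Steps-transport I.done = I₂.done
  Steps-transport (I.step I S) = I₂.step (Ins-transport I) (Steps-transport S)

-- Insertion of distinct letters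

StrictBump : ∀ {L : Set} → (L → ℕ) → Kind → L → L → Set
StrictBump κ _ a b = κ a < κ b

module StrictInsertion {L : Set} (κ : L → ℕ) (κ-injective : ∀ a b → κ a ≡ κ b → a ≡ b) where

  open Scanning (StrictBump κ) public

  κ-≯∧≢⇒< : ∀ a b → ¬ (κ b < κ a) → a ≢ b → κ a < κ b
  κ-≯∧≢⇒< a b b≮a a≢b with <-cmp (κ a) (κ b)
  ... | tri< a<b _ _ = a<b
  ... | tri≈ _ a≡b _ = ⊥-elim (a≢b (κ-injective a b a≡b))
  ... | tri> _ _ b<a = ⊥-elim (b≮a b<a)

  κ-<⇒≢ : ∀ {a b} → κ a < κ b → a ≢ b
  κ-<⇒≢ a<b refl = <-irrefl refl a<b

  record IsTableau (T : Tab L) : Set where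
    field
      increasing : ∀ k ℓ p q a b → p < q → at T (cell k ℓ p) ≡ just a → at T (cell k ℓ q) ≡ just b → κ a < κ b
      closed     : ∀ k ℓ p a → at T (cell k ℓ (suc p)) ≡ just a → Σ L λ b → at T (cell k ℓ p) ≡ just b
      distinct   : ∀ c d a → at T c ≡ just a → at T d ≡ just a → c ≡ d
  open IsTableau public

  emptyTab-isTableau : IsTableau emptyTab
  emptyTab-isTableau = record
    { increasing = λ { _ _ _ _ _ _ _ () _ }
    ; closed     = λ { _ _ _ _ () }
    ; distinct   = λ { _ _ _ () _ } }

  Fresh : Tab L → L → Set
  Fresh T w = ∀ c → at T c ≢ just w

  -- w, about to enter line ℓ+1, was bumped from position p₀ of line ℓ (both in w's own direction):
  -- the letter that replaced it there is smaller, and the cell of line ℓ+1 at p₀ is empty or larger.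
  BumpedFrom : Tab L → Kind → ℕ → L → ℕ → Set
  BumpedFrom T k zero    w p₀ = ⊤
  BumpedFrom T k (suc ℓ) w p₀ =
    (Σ L λ a → (at T (cell k ℓ p₀) ≡ just a) × (κ a < κ w)) ×
    ((at T (cell k (suc ℓ) p₀) ≡ nothing) ⊎ (Σ L λ b → (at T (cell k (suc ℓ) p₀) ≡ just b) × (κ w < κ b)))

  record Pending (T : Tab L) (k : Kind) (ℓ : ℕ) (w : L) : Set where
    constructor pending
    field
      fresh      : Fresh T w
      origin     : ℕ
      bumpedFrom : BumpedFrom T k ℓ w origin
  open Pending public

  module _ {T : Tab L} (isT : IsTableau T) where

    increasing-≤ : ∀ k ℓ p q a b → p ≤ q → at T (cell k ℓ p) ≡ just a → at T (cell k ℓ q) ≡ just b → κ a ≤ κ b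
    increasing-≤ k ℓ p q a b p≤q ea eb with m≤n⇒m<n∨m≡n p≤q
    ... | inj₁ p<q = <⇒≤ (increasing isT k ℓ p q a b p<q ea eb)
    ... | inj₂ refl with trans (sym ea) eb
    ...   | refl = ≤-refl

    closed-≤ : ∀ k ℓ q p a → q ≤ p → at T (cell k ℓ p) ≡ just a → Σ L λ b → (at T (cell k ℓ q) ≡ just b) × (κ b ≤ κ a)
    closed-≤ k ℓ q zero    a z≤n ea = a , ea , ≤-refl
    closed-≤ k ℓ q (suc p) a q≤p ea with m≤n⇒m<n∨m≡n q≤p
    ... | inj₂ refl = a , ea , ≤-refl
    ... | inj₁ (s≤s q≤p′) with closed isT k ℓ p a ea
    ...   | b , eb with closed-≤ k ℓ q p b q≤p′ eb
    ...     | c , ec , c≤b = c , ec , ≤-trans c≤b (<⇒≤ (increasing isT k ℓ p (suc p) b a ≤-refl eb ea))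

  Before-< : ∀ {T k ℓ p w} → Fresh T w → Before T k ℓ p w → ∀ q a → q < p → at T (cell k ℓ q) ≡ just a → κ a < κ w
  Before-< {T} {k} {ℓ} {w = w} fr before q a q<p ea with passed before q q<p
  ... | e , ee , w≮e with trans (sym ea) ee
  ...   | refl = κ-≯∧≢⇒< a w w≮e λ a≡w → fr (cell k ℓ q) (trans ea (cong just a≡w))

  Before-≤-origin : ∀ {T k ℓ p w p₀} → Before T k (suc ℓ) p w → BumpedFrom T k (suc ℓ) w p₀ → p ≤ p₀
  Before-≤-origin {p = p} {p₀ = p₀} before (_ , below) with <-cmp p₀ p
  ... | tri≈ _ p₀≡p _ = ≤-reflexive (sym p₀≡p)
  ... | tri> _ _ p<p₀ = <⇒≤ p<p₀
  ... | tri< p₀<p _ _ with passed before p₀ p₀<p | below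
  ...   | e , ee , _   | inj₁ empty with trans (sym empty) ee
  ...     | ()
  Before-≤-origin before (_ , below) | tri< p₀<p _ _ | e , ee , w≮e | inj₂ (b , eb , w<b) with trans (sym eb) ee
  ...     | refl = ⊥-elim (w≮e w<b)

  -- Every entry weakly before the replacing letter in both directions is at most that letter.
  BumpedFrom-< : ∀ {T k ℓ w p₀} → IsTableau T → BumpedFrom T k (suc ℓ) w p₀ →
                 ∀ p q a → p ≤ p₀ → q ≤ ℓ → at T (cell k q p) ≡ just a → κ a < κ w
  BumpedFrom-< {T} {k} {ℓ} {w} {p₀} isT ((a₀ , ea₀ , a₀<w) , _) p q a p≤p₀ q≤ℓ ea
    with closed-≤ isT k ℓ p p₀ a₀ p≤p₀ ea₀
  ... | e , ee , e≤a₀ =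
    ≤-<-trans (increasing-≤ isT (other k) p q ℓ a e q≤ℓ
                 (trans (cong (at T) (cell-other k p q)) ea) (trans (cong (at T) (cell-other k p ℓ)) ee))
              (≤-<-trans e≤a₀ a₀<w)

  earlier-line-filled : ∀ {T k ℓ p w} → IsTableau T → Pending T k ℓ w → Before T k ℓ p w →
                        ∀ q → q < ℓ → Σ L λ a → (at T (cell k q p) ≡ just a) × (κ a < κ w)
  earlier-line-filled {T} {k} {suc ℓ} {p} isT pend before q q<ℓ
    with Before-≤-origin before (bumpedFrom pend)
  ... | p≤p₀ with closed-≤ isT k ℓ p (origin pend) _ p≤p₀ (proj₁ (proj₂ (proj₁ (bumpedFrom pend))))
  ...   | e , ee , _ with closed-≤ isT (other k) p q ℓ e (≤-pred q<ℓ) (trans (cong (at T) (cell-other k p ℓ)) ee)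
  ...     | a , ea , _ =
    a , ea′ , BumpedFrom-< {k = k} isT (bumpedFrom pend) p q a p≤p₀ (≤-pred q<ℓ) ea′
    where
    ea′ : at T (cell k q p) ≡ just a
    ea′ = trans (cong (at T) (sym (cell-other k p q))) ea

  earlier-line-< : ∀ {T k ℓ p w} → IsTableau T → Pending T k ℓ w → Before T k ℓ p w →
                   ∀ q a → q < ℓ → at T (cell k q p) ≡ just a → κ a < κ w
  earlier-line-< isT pend before q a q<ℓ ea with earlier-line-filled isT pend before q q<ℓ
  ... | a′ , ea′ , a′<w with trans (sym ea) ea′
  ...   | refl = a′<w

  module Placing {T : Tab L} {k : Kind} {ℓ p : ℕ} {w : L}
                 (isT : IsTableau T) (pend : Pending T k ℓ w) (before : Before T k ℓ p w) where

    private
      cs : Cell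
      cs = cell k ℓ p

      T₁ : Tab L
      T₁ = upd T cs w

      unplaced : ∀ {d a} → d ≢ cs → at T₁ d ≡ just a → at T d ≡ just a
      unplaced d≢cs e = trans (sym (at-upd-≢ T cs w d≢cs)) e

      placed : ∀ {d a} → d ≡ cs → at T₁ d ≡ just a → a ≡ w
      placed refl e = just-injective (trans (sym e) (at-upd-≡ T cs w))

    before-cs-< : ∀ k₂ ℓ₂ q₁ q₂ a → q₁ < q₂ → cell k₂ ℓ₂ q₂ ≡ cs → at T (cell k₂ ℓ₂ q₁) ≡ just a → κ a < κ w
    before-cs-< k₂ ℓ₂ q₁ q₂ a q₁<q₂ e ea with same-or-other k k₂
    ... | inj₁ refl with cell-injective k e
    ...   | refl , refl = Before-< (fresh pend) before q₁ a q₁<q₂ ea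
    before-cs-< k₂ ℓ₂ q₁ q₂ a q₁<q₂ e ea | inj₂ refl with cell-injective k (trans (sym (cell-other k ℓ₂ q₂)) e)
    ...   | refl , refl = earlier-line-< isT pend before q₁ a q₁<q₂ (trans (cong (at T) (sym (cell-other k ℓ₂ q₁))) ea)

    before-cs-filled : ∀ k₂ ℓ₂ q → cell k₂ ℓ₂ (suc q) ≡ cs → Σ L λ b → at T (cell k₂ ℓ₂ q) ≡ just b
    before-cs-filled k₂ ℓ₂ q e with same-or-other k k₂
    ... | inj₁ refl with cell-injective k e
    ...   | refl , refl = proj₁ (passed before q ≤-refl) , proj₁ (proj₂ (passed before q ≤-refl))
    before-cs-filled k₂ ℓ₂ q e | inj₂ refl with cell-injective k (trans (sym (cell-other k ℓ₂ (suc q))) e)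
    ...   | refl , refl with earlier-line-filled isT pend before q ≤-refl
    ...     | b , eb , _ = b , trans (cong (at T) (cell-other k ℓ₂ q)) eb

    after-cs-> : Stop T k ℓ p w → ∀ k₂ ℓ₂ q₁ q₂ b → q₁ < q₂ → cell k₂ ℓ₂ q₁ ≡ cs →
                 at T (cell k₂ ℓ₂ q₂) ≡ just b → κ w < κ b
    after-cs-> (blocked atz w<z) k₂ ℓ₂ q₁ q₂ b q₁<q₂ e eb =
      <-trans w<z (increasing isT k₂ ℓ₂ q₁ q₂ _ b q₁<q₂ (trans (cong (at T) e) atz) eb)
    after-cs-> (vacant empty) k₂ ℓ₂ q₁ q₂ b q₁<q₂ e eb with closed-≤ isT k₂ ℓ₂ q₁ q₂ b (<⇒≤ q₁<q₂) eb
    ... | _ , eq₁ , _ with trans (sym (trans (cong (at T) e) empty)) eq₁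
    ...   | ()

    placed-isTableau : Stop T k ℓ p w → IsTableau T₁
    placed-isTableau stop = record { increasing = incr ; closed = clos ; distinct = dist }
      where
      incr : ∀ k₂ ℓ₂ q₁ q₂ a b → q₁ < q₂ → at T₁ (cell k₂ ℓ₂ q₁) ≡ just a → at T₁ (cell k₂ ℓ₂ q₂) ≡ just b → κ a < κ b
      incr k₂ ℓ₂ q₁ q₂ a b q₁<q₂ ea eb with cell k₂ ℓ₂ q₁ ≟ᶜ cs | cell k₂ ℓ₂ q₂ ≟ᶜ cs
      ... | yes e₁ | yes e₂ = ⊥-elim (<-irrefl (proj₂ (cell-injective k₂ (trans e₁ (sym e₂)))) q₁<q₂)
      ... | yes e₁ | no n₂ with placed e₁ ea
      ...   | refl = after-cs-> stop k₂ ℓ₂ q₁ q₂ b q₁<q₂ e₁ (unplaced n₂ eb)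
      incr k₂ ℓ₂ q₁ q₂ a b q₁<q₂ ea eb | no n₁ | yes e₂ with placed e₂ eb
      ...   | refl = before-cs-< k₂ ℓ₂ q₁ q₂ a q₁<q₂ e₂ (unplaced n₁ ea)
      incr k₂ ℓ₂ q₁ q₂ a b q₁<q₂ ea eb | no n₁ | no n₂ =
        increasing isT k₂ ℓ₂ q₁ q₂ a b q₁<q₂ (unplaced n₁ ea) (unplaced n₂ eb)

      clos : ∀ k₂ ℓ₂ q a → at T₁ (cell k₂ ℓ₂ (suc q)) ≡ just a → Σ L λ b → at T₁ (cell k₂ ℓ₂ q) ≡ just b
      clos k₂ ℓ₂ q a ea with cell k₂ ℓ₂ q ≟ᶜ cs | cell k₂ ℓ₂ (suc q) ≟ᶜ cs
      ... | yes e  | _      = w , trans (cong (at T₁) e) (at-upd-≡ T cs w)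
      ... | no n   | yes e₂ = let b , eb = before-cs-filled k₂ ℓ₂ q e₂ in b , trans (at-upd-≢ T cs w n) eb
      ... | no n   | no n₂  = let b , eb = closed isT k₂ ℓ₂ q a (unplaced n₂ ea) in b , trans (at-upd-≢ T cs w n) eb

      dist : ∀ c d a → at T₁ c ≡ just a → at T₁ d ≡ just a → c ≡ d
      dist c d a ea eb with at-upd-just T cs w ea | at-upd-just T cs w eb
      ... | inj₁ (refl , _)    | inj₁ (refl , _)    = refl
      ... | inj₁ (_ , refl)    | inj₂ (_ , eb′)     = ⊥-elim (fresh pend d eb′)
      ... | inj₂ (_ , ea′)     | inj₁ (_ , refl)    = ⊥-elim (fresh pend c ea′)
      ... | inj₂ (_ , ea′)     | inj₂ (_ , eb′)     = distinct isT c d a ea′ eb′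

    bumped-pending : ∀ {z} → at T cs ≡ just z → κ w < κ z → ∀ k′ → Pending T₁ k′ (suc (lineOf k′ cs)) z
    bumped-pending {z} atz w<z k′ = pending fresh₁ (posOf k′ cs) (replaced , below)
      where
      fresh₁ : Fresh T₁ z
      fresh₁ c ec with at-upd-just T cs w ec
      ... | inj₁ (_ , z≡w)   = κ-<⇒≢ w<z (sym z≡w)
      ... | inj₂ (c≢cs , ec′) = c≢cs (distinct isT c cs z ec′ atz)

      replaced : Σ L λ a → (at T₁ (cell k′ (lineOf k′ cs) (posOf k′ cs)) ≡ just a) × (κ a < κ z)
      replaced = w , trans (cong (at T₁) (cell-lineOf-posOf k′ cs)) (at-upd-≡ T cs w) , w<z

      below-≢ : cell k′ (suc (lineOf k′ cs)) (posOf k′ cs) ≢ cs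
      below-≢ e = 1+n≢n (proj₁ (cell-injective k′ (trans e (sym (cell-lineOf-posOf k′ cs)))))

      below : (at T₁ (cell k′ (suc (lineOf k′ cs)) (posOf k′ cs)) ≡ nothing) ⊎
              (Σ L λ b → (at T₁ (cell k′ (suc (lineOf k′ cs)) (posOf k′ cs)) ≡ just b) × (κ z < κ b))
      below with at T (cell k′ (suc (lineOf k′ cs)) (posOf k′ cs)) in eb
      ... | nothing = inj₁ (trans (at-upd-≢ T cs w below-≢) eb)
      ... | just b  = inj₂ (b , trans (at-upd-≢ T cs w below-≢) eb ,
                            increasing isT (other k′) (posOf k′ cs) (lineOf k′ cs) (suc (lineOf k′ cs)) z b ≤-refl
                              (trans (cong (at T) (trans (cell-other k′ _ _) (cell-lineOf-posOf k′ cs))) atz)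
                              (trans (cong (at T) (cell-other k′ _ _)) eb))

  bump-preserves : ∀ {T k ℓ p w z} → IsTableau T → Pending T k ℓ w → Before T k ℓ p w →
                   at T (cell k ℓ p) ≡ just z → κ w < κ z → ∀ k′ →
                   IsTableau (upd T (cell k ℓ p) w) × Pending (upd T (cell k ℓ p) w) k′ (suc (lineOf k′ (cell k ℓ p))) z
  bump-preserves isT pend before atz w<z k′ =
    Placing.placed-isTableau isT pend before (blocked atz w<z) , Placing.bumped-pending isT pend before atz w<z k′

  module StrictInsertionOf (kind : L → Kind) where
    open GenericInsertion kind (StrictBump κ) public
      hiding (Before; mkBefore; passed; Stop; blocked; vacant; Before-Stop-<; scan-unique)

    ins-entries : ∀ {T ℓ w T₂ c} → Ins T ℓ w T₂ c → ∀ d a → at T₂ d ≡ just a → (a ≡ w) ⊎ (Σ Cell λ d₂ → at T d₂ ≡ just a)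
    ins-entries {T} (bump {ℓ = ℓ} {w} {k} {p} _ _ atz _ D) d a ea with ins-entries D d a ea
    ... | inj₁ refl = inj₂ (cell k ℓ p , atz)
    ... | inj₂ (d₂ , ed₂) with at-upd-just T (cell k ℓ p) w ed₂
    ...   | inj₁ (_ , a≡w)    = inj₁ a≡w
    ...   | inj₂ (_ , ed₂′)   = inj₂ (d₂ , ed₂′)
    ins-entries {T} (new {ℓ = ℓ} {w} {k} {p} _ _ _) d a ea with at-upd-just T (cell k ℓ p) w ea
    ... | inj₁ (_ , a≡w)  = inj₁ a≡w
    ... | inj₂ (_ , ea′)  = inj₂ (d , ea′)

    ins-isTableau : ∀ {T ℓ w T₂ c} → Ins T ℓ w T₂ c → IsTableau T → Pending T (kind w) ℓ w → IsTableau T₂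
    ins-isTableau (bump {z = z} refl before atz w<z D) isT pend =
      let isT₁ , pend₁ = bump-preserves isT pend before atz w<z (kind z) in ins-isTableau D isT₁ pend₁
    ins-isTableau (new refl before empty) isT pend = Placing.placed-isTableau isT pend before (vacant empty)

-- Standardization

RankBump : Variant → ℕ → ℕ → Set
RankBump regular x y = x < y
RankBump dual    x y = x ≤ y

Precedes : ∀ {n} → Variant → Fin n → Fin n → Set
Precedes regular a b = a F.< b
Precedes dual    a b = b F.< a

module Standardization {n : ℕ} (kind : Fin n → Kind) (var : Kind → Variant) (ρ κ : Fin n → ℕ)
  (κ-injective : ∀ a b → κ a ≡ κ b → a ≡ b)
  (ρ-kind : ∀ a b → ρ a ≡ ρ b → kind a ≡ kind b)
  (κ<⇒ : ∀ a b → κ a < κ b → (ρ a < ρ b) ⊎ ((ρ a ≡ ρ b) × Precedes (var (kind a)) a b))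
  (⇒κ< : ∀ a b → (ρ a < ρ b) ⊎ ((ρ a ≡ ρ b) × Precedes (var (kind a)) a b) → κ a < κ b) where

  open StrictInsertion κ κ-injective

  RankedBump : Kind → Fin n → Fin n → Set
  RankedBump k a b = RankBump (var k) (ρ a) (ρ b)

  module R = GenericInsertion kind RankedBump
  module S = StrictInsertionOf kind

  κ<⇒ρ≤ : ∀ a b → κ a < κ b → ρ a ≤ ρ b
  κ<⇒ρ≤ a b a<b with κ<⇒ a b a<b
  ... | inj₁ ρa<ρb     = <⇒≤ ρa<ρb
  ... | inj₂ (ρa≡ρb , _) = ≤-reflexive ρa≡ρb

  between-copies : ∀ a b c → κ a < κ b → κ b < κ c → ρ a ≡ ρ c → ρ b ≡ ρ a
  between-copies a b c a<b b<c ρa≡ρc = ≤-antisym (≤-trans (κ<⇒ρ≤ b c b<c) (≤-reflexive (sym ρa≡ρc))) (κ<⇒ρ≤ a b a<b)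

  copy-κ<⇒Precedes : ∀ a b → ρ a ≡ ρ b → κ a < κ b → Precedes (var (kind a)) a b
  copy-κ<⇒Precedes a b ρa≡ρb a<b with κ<⇒ a b a<b
  ... | inj₁ ρa<ρb    = ⊥-elim (<-irrefl ρa≡ρb ρa<ρb)
  ... | inj₂ (_ , pr) = pr

  copy-Precedes⇒κ< : ∀ a b → ρ a ≡ ρ b → Precedes (var (kind a)) a b → κ a < κ b
  copy-Precedes⇒κ< a b ρa≡ρb pr = ⇒κ< a b (inj₂ (ρa≡ρb , pr))

  StripOrder : Kind → Variant → Cell → Cell → Set
  StripOrder k regular c₁ c₂ = posOf k c₁ < posOf k c₂
  StripOrder k dual    c₁ c₂ = lineOf k c₂ < lineOf k c₁

  -- A later copy of a letter lies on a weakly earlier line and strictly further along (regular) or on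
  -- a strictly earlier line (dual): the copies form a horizontal resp. vertical strip.
  Strip : Tab (Fin n) → Set
  Strip T = ∀ c₁ c₂ a b → at T c₁ ≡ just a → at T c₂ ≡ just b → ρ a ≡ ρ b → a F.< b →
            (lineOf (kind a) c₂ ≤ lineOf (kind a) c₁) × StripOrder (kind a) (var (kind a)) c₁ c₂

  record StdPending (T : Tab (Fin n)) (ℓ : ℕ) (w : Fin n) : Set where
    constructor stdPending
    field
      pend           : Pending T (kind w) ℓ w
      earlier-copies : ∀ c a → at T c ≡ just a → ρ a ≡ ρ w → a F.< w → ℓ ≤ lineOf (kind w) c
      later-copies   : ∀ c a → at T c ≡ just a → ρ a ≡ ρ w → w F.< a →
                       (lineOf (kind w) c < ℓ) × (var (kind w) ≡ regular → origin pend < posOf (kind w) c)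
  open StdPending

  copies-on-line : ∀ {T ℓ w} → StdPending T ℓ w → ∀ q e → at T (cell (kind w) ℓ q) ≡ just e → ρ e ≡ ρ w → e F.< w
  copies-on-line {ℓ = ℓ} {w} sp q e ee ρe≡ρw with <-cmp (F.toℕ e) (F.toℕ w)
  ... | tri< e<w _ _ = e<w
  ... | tri≈ _ e≡w _ = ⊥-elim (fresh (pend sp) _ (trans ee (cong just (FP.toℕ-injective e≡w))))
  ... | tri> _ _ w<e = ⊥-elim (<-irrefl (lineOf-cell (kind w) ℓ q) (proj₁ (later-copies sp _ e ee ρe≡ρw w<e)))

  -- On the target line the only copies of w are earlier ones, which a regular w passes and a dual w bumps;
  -- this is exactly how the standardized order ranks them.
  RankedBump⇔κ< : ∀ {T ℓ w} → StdPending T ℓ w → ∀ q e → at T (cell (kind w) ℓ q) ≡ just e →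
                  (RankedBump (kind w) w e → κ w < κ e) × (κ w < κ e → RankedBump (kind w) w e)
  RankedBump⇔κ< {w = w} sp q e ee with <-cmp (ρ w) (ρ e)
  ... | tri< ρw<ρe _ _ = (λ _ → ⇒κ< w e (inj₁ ρw<ρe)) , (λ _ → bumps (var (kind w)))
    where
    bumps : ∀ v → RankBump v (ρ w) (ρ e)
    bumps regular = ρw<ρe
    bumps dual    = <⇒≤ ρw<ρe
  ... | tri> _ _ ρe<ρw = (λ b → ⊥-elim (passes (var (kind w)) b)) , (λ w<e → ⊥-elim (<⇒≱ ρe<ρw (κ<⇒ρ≤ w e w<e)))
    where
    passes : ∀ v → ¬ RankBump v (ρ w) (ρ e)
    passes regular = <-asym ρe<ρw
    passes dual    = <⇒≱ ρe<ρw
  ... | tri≈ _ ρw≡ρe _ = to , from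
    where
    e<w : e F.< w
    e<w = copies-on-line sp q e ee (sym ρw≡ρe)
    to : RankBump (var (kind w)) (ρ w) (ρ e) → κ w < κ e
    to b = copy-Precedes⇒κ< w e ρw≡ρe (precedes (var (kind w)) b)
      where
      precedes : ∀ v → RankBump v (ρ w) (ρ e) → Precedes v w e
      precedes regular ρw<ρe = ⊥-elim (<-irrefl ρw≡ρe ρw<ρe)
      precedes dual    _     = e<w
    from : κ w < κ e → RankBump (var (kind w)) (ρ w) (ρ e)
    from w<e = bumps (var (kind w)) (copy-κ<⇒Precedes w e ρw≡ρe w<e)
      where
      bumps : ∀ v → Precedes v w e → RankBump v (ρ w) (ρ e)
      bumps regular w<e′ = ⊥-elim (<-asym w<e′ e<w)
      bumps dual    _    = ≤-reflexive ρw≡ρe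

  Before-standardize : ∀ {T ℓ p w} → StdPending T ℓ w → R.Before T (kind w) ℓ p w → Before T (kind w) ℓ p w
  Before-standardize sp before = mkBefore λ q q<p →
    let e , ee , ¬bump = R.passed before q q<p in e , ee , λ w<e → ¬bump (proj₂ (RankedBump⇔κ< sp q e ee) w<e)

  dual-copies-on-different-lines : ∀ {T} → Strip T → ∀ c₁ c₂ a b → at T c₁ ≡ just a → at T c₂ ≡ just b →
                                   ρ a ≡ ρ b → a ≢ b → var (kind a) ≡ dual → lineOf (kind a) c₁ ≢ lineOf (kind a) c₂
  dual-copies-on-different-lines strip c₁ c₂ a b ea eb ρa≡ρb a≢b dual-a same-line with <-cmp (F.toℕ a) (F.toℕ b)
  ... | tri≈ _ a≡b _ = a≢b (FP.toℕ-injective a≡b)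
  ... | tri< a<b _ _ with strip c₁ c₂ a b ea eb ρa≡ρb a<b
  ...   | _ , order rewrite dual-a = <-irrefl (sym same-line) order
  dual-copies-on-different-lines strip c₁ c₂ a b ea eb ρa≡ρb a≢b dual-a same-line | tri> _ _ b<a
    with strip c₂ c₁ b a eb ea (sym ρa≡ρb) b<a
  ...   | _ , order rewrite sym (ρ-kind a b ρa≡ρb) | dual-a = <-irrefl same-line order

  Before-≤-origin′ : ∀ {T k ℓ p w p₀ x} → Before T k ℓ p w → BumpedFrom T k ℓ w p₀ → x < ℓ → p ≤ p₀
  Before-≤-origin′ {ℓ = suc ℓ} before from _ = Before-≤-origin before from

  Stop-quadrant-< : ∀ {T k ℓ p w} → IsTableau T → Stop T k ℓ p w →
                    ∀ ℓ₁ q e → ℓ ≤ ℓ₁ → p ≤ q → at T (cell k ℓ₁ q) ≡ just e → κ w < κ e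
  Stop-quadrant-< {T} {k} {ℓ} {p} isT stop ℓ₁ q e ℓ≤ℓ₁ p≤q ee
    with closed-≤ isT (other k) q ℓ ℓ₁ e ℓ≤ℓ₁ (trans (cong (at T) (cell-other k q ℓ₁)) ee)
  ... | e₂ , ee₂ , e₂≤e = go stop
    where
    ee₂′ : at T (cell k ℓ q) ≡ just e₂
    ee₂′ = trans (cong (at T) (sym (cell-other k q ℓ))) ee₂
    go : Stop T k ℓ p _ → κ _ < κ e
    go (blocked atz w<z) = <-≤-trans w<z (≤-trans (increasing-≤ isT k ℓ p q _ e₂ p≤q atz ee₂′) e₂≤e)
    go (vacant empty) with closed-≤ isT k ℓ p q e₂ p≤q ee₂′
    ... | _ , eb , _ with trans (sym empty) eb
    ...   | ()

  module StripPlacing {T : Tab (Fin n)} {ℓ p : ℕ} {w : Fin n} (isT : IsTableau T) (strip : Strip T)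
                      (sp : StdPending T ℓ w) (before : Before T (kind w) ℓ p w) (stop : Stop T (kind w) ℓ p w) where
    k : Kind
    k = kind w

    cs : Cell
    cs = cell k ℓ p

    -- A later copy sits on an earlier line, beyond the origin of w; hence beyond cs.
    order-to-later : ∀ c₂ → (var k ≡ regular → origin (pend sp) < posOf k c₂) → lineOf k c₂ < ℓ → StripOrder k (var k) cs c₂
    order-to-later c₂ beyond earlier = go (var k) refl
      where
      go : ∀ v → var k ≡ v → StripOrder k v cs c₂
      go regular reg = subst (_< posOf k c₂) (sym (posOf-cell k ℓ p))
                         (≤-<-trans (Before-≤-origin′ before (bumpedFrom (pend sp)) earlier) (beyond reg))
      go dual _ = subst (lineOf k c₂ <_) (sym (lineOf-cell k ℓ p)) earlier

    -- On the target line an earlier dual copy a of w exceeds w: before cs it would have stopped w, and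
    -- beyond cs it would share its line with the letter z that stopped w, itself a copy of w.
    dual-earlier-copy-off-line : ∀ c₁ a → c₁ ≢ cs → at T c₁ ≡ just a → ρ a ≡ ρ w → a F.< w → var k ≡ dual →
                                 ℓ ≡ lineOf k c₁ → ⊥
    dual-earlier-copy-off-line c₁ a c₁≢cs ea ρa≡ρw a<w dl ℓ≡ = on-line (<-cmp (posOf k c₁) p)
      where
      w<a : κ w < κ a
      w<a = copy-Precedes⇒κ< w a (sym ρa≡ρw) (subst (λ v → Precedes v w a) (sym dl) a<w)
      ea₂ : at T (cell k ℓ (posOf k c₁)) ≡ just a
      ea₂ = trans (cong (λ x → at T (cell k x (posOf k c₁))) ℓ≡) (trans (cong (at T) (cell-lineOf-posOf k c₁)) ea)
      on-line : Tri (posOf k c₁ < p) (posOf k c₁ ≡ p) (posOf k c₁ > p) → ⊥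
      on-line (tri< c₁<p _ _) = <-asym w<a (Before-< (fresh (pend sp)) before (posOf k c₁) a c₁<p ea₂)
      on-line (tri≈ _ c₁≡p _) = c₁≢cs (trans (sym (cell-lineOf-posOf k c₁)) (cong₂ (cell k) (sym ℓ≡) c₁≡p))
      on-line (tri> _ _ p<c₁) = beyond stop
        where
        beyond : Stop T k ℓ p w → ⊥
        beyond (blocked {z} atz w<z) =
          dual-copies-on-different-lines strip cs c₁ z a atz ea (trans ρz≡ρw (sym ρa≡ρw)) z≢a
            (trans (cong var (ρ-kind z w ρz≡ρw)) dl)
            (subst (λ k′ → lineOf k′ cs ≡ lineOf k′ c₁) (sym (ρ-kind z w ρz≡ρw)) (trans (lineOf-cell k ℓ p) ℓ≡))
          where
          z<a : κ z < κ a
          z<a = increasing isT k ℓ p (posOf k c₁) z a p<c₁ atz ea₂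
          ρz≡ρw : ρ z ≡ ρ w
          ρz≡ρw = between-copies w z a w<z z<a (sym ρa≡ρw)
          z≢a : z ≢ a
          z≢a refl = c₁≢cs (sym (distinct isT cs c₁ z atz ea))
        beyond (vacant empty) with closed-≤ isT k ℓ p (posOf k c₁) a (<⇒≤ p<c₁) ea₂
        ... | _ , eb , _ with trans (sym empty) eb
        ...   | ()

    order-from-earlier : ∀ c₁ a → c₁ ≢ cs → at T c₁ ≡ just a → ρ a ≡ ρ w → a F.< w → ℓ ≤ lineOf k c₁ →
                         StripOrder k (var k) c₁ cs
    order-from-earlier c₁ a c₁≢cs ea ρa≡ρw a<w ℓ≤ = go (var k) refl
      where
      ea₁ : at T (cell k (lineOf k c₁) (posOf k c₁)) ≡ just a
      ea₁ = trans (cong (at T) (cell-lineOf-posOf k c₁)) ea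
      a<w-κ : var k ≡ regular → κ a < κ w
      a<w-κ reg = copy-Precedes⇒κ< a w ρa≡ρw (subst (λ v → Precedes v a w) (sym (trans (cong var (ρ-kind a w ρa≡ρw)) reg)) a<w)
      go : ∀ v → var k ≡ v → StripOrder k v c₁ cs
      go regular reg with <-cmp (posOf k c₁) p
      ... | tri< c₁<p _ _ = subst (posOf k c₁ <_) (sym (posOf-cell k ℓ p)) c₁<p
      ... | tri≈ _ c₁≡p _ = ⊥-elim (<-asym (Stop-quadrant-< isT stop _ _ a ℓ≤ (≤-reflexive (sym c₁≡p)) ea₁) (a<w-κ reg))
      ... | tri> _ _ p<c₁ = ⊥-elim (<-asym (Stop-quadrant-< isT stop _ _ a ℓ≤ (<⇒≤ p<c₁) ea₁) (a<w-κ reg))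
      go dual dl with m≤n⇒m<n∨m≡n ℓ≤
      ... | inj₁ ℓ<  = subst (_< lineOf k c₁) (sym (lineOf-cell k ℓ p)) ℓ<
      ... | inj₂ ℓ≡ = ⊥-elim (dual-earlier-copy-off-line c₁ a c₁≢cs ea ρa≡ρw a<w dl ℓ≡)

    placed-strip : Strip (upd T cs w)
    placed-strip c₁ c₂ a b ea eb ρa≡ρb a<b with at-upd-just T cs w ea | at-upd-just T cs w eb
    ... | inj₁ (refl , refl) | inj₁ (refl , refl) = ⊥-elim (<-irrefl refl a<b)
    ... | inj₁ (refl , refl) | inj₂ (_ , eb′) with later-copies sp c₂ b eb′ (sym ρa≡ρb) a<b
    ...   | earlier , beyond = subst (lineOf k c₂ ≤_) (sym (lineOf-cell k ℓ p)) (<⇒≤ earlier) , order-to-later c₂ beyond earlier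
    placed-strip c₁ c₂ a b ea eb ρa≡ρb a<b | inj₂ (c₁≢cs , ea′) | inj₁ (refl , refl) rewrite ρ-kind a w ρa≡ρb =
      subst (_≤ lineOf k c₁) (sym (lineOf-cell k ℓ p)) ℓ≤ , order-from-earlier c₁ a c₁≢cs ea′ ρa≡ρb a<b ℓ≤
      where
      ℓ≤ : ℓ ≤ lineOf k c₁
      ℓ≤ = earlier-copies sp c₁ a ea′ ρa≡ρb a<b
    placed-strip c₁ c₂ a b ea eb ρa≡ρb a<b | inj₂ (_ , ea′) | inj₂ (_ , eb′) = strip c₁ c₂ a b ea′ eb′ ρa≡ρb a<b

  module StripBumping {T : Tab (Fin n)} {ℓ p : ℕ} {w z : Fin n} (isT : IsTableau T) (strip : Strip T)
                      (sp : StdPending T ℓ w) (before : Before T (kind w) ℓ p w)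
                      (atz : at T (cell (kind w) ℓ p) ≡ just z) (w<z : κ w < κ z) where
    open StripPlacing isT strip sp before (blocked atz w<z)

    kz : Kind
    kz = kind z

    copy-between : ∀ a → ρ a ≡ ρ z → κ a < κ w → ρ w ≡ ρ z
    copy-between a ρa≡ρz a<w = trans (between-copies a w z a<w w<z ρa≡ρz) ρa≡ρz

    -- A regular copy of z before cs on z's line would lie below w, making w a copy of z: on w's own
    -- line a later one, on a crossing line one of the other kind.
    regular-copy-not-before-cs : ∀ c₁ a → at T c₁ ≡ just a → ρ a ≡ ρ z → var kz ≡ regular →
                                 lineOf kz cs ≡ lineOf kz c₁ → posOf kz c₁ < posOf kz cs → ⊥
    regular-copy-not-before-cs c₁ a ea ρa≡ρz reg same-line pos< with same-or-other k kz
    ... | inj₁ kz≡k =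
      <-asym (copies-on-line sp p z atz (sym (copy-between a ρa≡ρz a<w)))
             (subst (λ v → Precedes v w z) (trans (cong var (sym kz≡k)) reg) (copy-κ<⇒Precedes w z (copy-between a ρa≡ρz a<w) w<z))
      where
      ℓ≡ : ℓ ≡ lineOf k c₁
      ℓ≡ = trans (sym (lineOf-cell k ℓ p)) (subst (λ k′ → lineOf k′ cs ≡ lineOf k′ c₁) kz≡k same-line)
      pos<p : posOf k c₁ < p
      pos<p = subst (posOf k c₁ <_) (posOf-cell k ℓ p) (subst (λ k′ → posOf k′ c₁ < posOf k′ cs) kz≡k pos<)
      ea₂ : at T (cell k ℓ (posOf k c₁)) ≡ just a
      ea₂ = trans (cong (λ x → at T (cell k x (posOf k c₁))) ℓ≡) (trans (cong (at T) (cell-lineOf-posOf k c₁)) ea)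
      a<w : κ a < κ w
      a<w = Before-< (fresh (pend sp)) before (posOf k c₁) a pos<p ea₂
    ... | inj₂ kz≡other = other-≢ k (sym (trans (ρ-kind w z (copy-between a ρa≡ρz a<w)) kz≡other))
      where
      p≡ : p ≡ lineOf (other k) c₁
      p≡ = trans (sym (lineOf-other-cell k ℓ p)) (subst (λ k′ → lineOf k′ cs ≡ lineOf k′ c₁) kz≡other same-line)
      pos<ℓ : posOf (other k) c₁ < ℓ
      pos<ℓ = subst (posOf (other k) c₁ <_) (posOf-other-cell k ℓ p)
                (subst (λ k′ → posOf k′ c₁ < posOf k′ cs) kz≡other pos<)
      ea₂ : at T (cell k (posOf (other k) c₁) p) ≡ just a
      ea₂ = trans (cong (at T) (sym (cell-other k p (posOf (other k) c₁))))
              (trans (cong (λ x → at T (cell (other k) x (posOf (other k) c₁))) p≡)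
                     (trans (cong (at T) (cell-lineOf-posOf (other k) c₁)) ea))
      a<w : κ a < κ w
      a<w = earlier-line-< isT (pend sp) before (posOf (other k) c₁) a pos<ℓ ea₂

    earlier-copies₁ : ∀ c₁ a → at (upd T cs w) c₁ ≡ just a → ρ a ≡ ρ z → a F.< z → suc (lineOf kz cs) ≤ lineOf kz c₁
    earlier-copies₁ c₁ a ea ρa≡ρz a<z with at-upd-just T cs w ea
    ... | inj₁ (refl , refl) = ⊥-elim (<-asym a<z (copies-on-line sp p z atz (sym ρa≡ρz)))
    ... | inj₂ (_ , ea′) with strip c₁ cs a z ea′ atz ρa≡ρz a<z
    ...   | line≤ , order rewrite ρ-kind a z ρa≡ρz = go (var kz) refl order
      where
      go : ∀ v → var kz ≡ v → StripOrder kz v c₁ cs → suc (lineOf kz cs) ≤ lineOf kz c₁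
      go dual    _   order′ = order′
      go regular reg order′ with m≤n⇒m<n∨m≡n line≤
      ... | inj₁ line<     = line<
      ... | inj₂ same-line = ⊥-elim (regular-copy-not-before-cs c₁ a ea′ ρa≡ρz reg same-line order′)

    later-copies₁ : ∀ c₁ a → at (upd T cs w) c₁ ≡ just a → ρ a ≡ ρ z → z F.< a →
                    (lineOf kz c₁ < suc (lineOf kz cs)) × (var kz ≡ regular → posOf kz cs < posOf kz c₁)
    later-copies₁ c₁ a ea ρa≡ρz z<a with at-upd-just T cs w ea
    ... | inj₁ (refl , refl) =
      n<1+n _ , λ reg → ⊥-elim (<-asym z<a (subst (λ v → Precedes v a z) (trans (cong var (ρ-kind a z ρa≡ρz)) reg)
                                                    (copy-κ<⇒Precedes a z ρa≡ρz w<z)))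
    ... | inj₂ (_ , ea′) with strip cs c₁ z a atz ea′ (sym ρa≡ρz) z<a
    ...   | line≤ , order = s≤s line≤ , λ reg → subst (λ v → StripOrder kz v cs c₁) reg order

    bumped-stdPending : StdPending (upd T cs w) (suc (lineOf kz cs)) z
    bumped-stdPending = stdPending (Placing.bumped-pending isT (pend sp) before atz w<z kz) earlier-copies₁ later-copies₁

  fresh-stdPending : ∀ {T w} → (∀ c a → at T c ≡ just a → a F.< w) → StdPending T 0 w
  fresh-stdPending {w = w} entries<w =
    stdPending (pending (λ c ec → <-irrefl refl (entries<w c w ec)) 0 tt)
               (λ _ _ _ _ _ → z≤n) (λ c a ea _ w<a → ⊥-elim (<-asym w<a (entries<w c a ea)))

  Ins-standardize : ∀ {T ℓ w T₂ c} → R.Ins T ℓ w T₂ c → IsTableau T → Strip T → StdPending T ℓ w →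
                    S.Ins T ℓ w T₂ c × Strip T₂
  Ins-standardize {T} {ℓ} {w} {T₂} {c} (R.bump {p = p} {z} refl before atz bumps D) isT strip sp =
    S.bump refl before′ atz w<z (proj₁ rest) , proj₂ rest
    where
    before′ : Before T (kind w) ℓ p w
    before′ = Before-standardize sp before
    w<z : κ w < κ z
    w<z = proj₁ (RankedBump⇔κ< sp p z atz) bumps
    rest : S.Ins (upd T (cell (kind w) ℓ p) w) (suc (lineOf (kind z) (cell (kind w) ℓ p))) z T₂ c × Strip T₂
    rest = Ins-standardize D (Placing.placed-isTableau isT (pend sp) before′ (blocked atz w<z))
                             (StripPlacing.placed-strip isT strip sp before′ (blocked atz w<z))
                             (StripBumping.bumped-stdPending isT strip sp before′ atz w<z)
  Ins-standardize {T} {ℓ} {w} (R.new {p = p} refl before empty) isT strip sp =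
    S.new refl before′ empty , StripPlacing.placed-strip isT strip sp before′ (vacant empty)
    where
    before′ : Before T (kind w) ℓ p w
    before′ = Before-standardize sp before

  Steps-standardize : ∀ {m T Q ws T₂ Q₂} → R.Steps m T Q ws T₂ Q₂ → IsTableau T → Strip T →
                      (∀ c a → at T c ≡ just a → All (a F.<_) ws) → AllPairs F._<_ ws → S.Steps m T Q ws T₂ Q₂
  Steps-standardize R.done _ _ _ _ = S.done
  Steps-standardize {T = T} (R.step {x = x} {xs} {P₁} {c} I S) isT strip entries< (x<xs ∷ sorted) =
    S.step I′ (Steps-standardize S (S.ins-isTableau I′ isT (pend sp)) strip₁ entries₁< sorted)
    where
    sp : StdPending T 0 x
    sp = fresh-stdPending (λ c a ea → All.head (entries< c a ea))
    I′ : S.Ins T 0 x P₁ c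
    I′ = proj₁ (Ins-standardize I isT strip sp)
    strip₁ : Strip P₁
    strip₁ = proj₂ (Ins-standardize I isT strip sp)
    entries₁< : ∀ c a → at P₁ c ≡ just a → All (a F.<_) xs
    entries₁< c a ea with S.ins-entries I′ c a ea
    ... | inj₁ refl     = x<xs
    ... | inj₂ (d , ed) = All.tail (entries< d a ed)

-- Exchanging neighbouring letters

module AdjacentSwap {L : Set} (_≟_ : DecidableEquality L) (kind : L → Kind) (κA κB : L → ℕ)
  (κA-injective : ∀ a b → κA a ≡ κA b → a ≡ b) (κB-injective : ∀ a b → κB a ≡ κB b → a ≡ b)
  (x y : L) (kind-y : kind y ≡ other (kind x)) (x<y : κA x < κA y)
  (κB-x : κB x ≡ κA y) (κB-y : κB y ≡ κA x) (κB-else : ∀ e → e ≢ x → e ≢ y → κB e ≡ κA e)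
  (adjacent : ∀ e → e ≢ x → e ≢ y → (κA e < κA x) ⊎ (κA y < κA e)) where

  module A = StrictInsertion κA κA-injective
  module B = StrictInsertion κB κB-injective
  module IA = A.StrictInsertionOf kind
  module IB = B.StrictInsertionOf kind

  y<x-B : κB y < κB x
  y<x-B = subst₂ _<_ (sym κB-y) (sym κB-x) x<y

  <y⇒<x : ∀ e → e ≢ x → e ≢ y → κA e < κA y → κA e < κA x
  <y⇒<x e e≢x e≢y e<y with adjacent e e≢x e≢y
  ... | inj₁ e<x = e<x
  ... | inj₂ y<e = ⊥-elim (<-asym e<y y<e)

  x<⇒y< : ∀ e → e ≢ x → e ≢ y → κA x < κA e → κA y < κA e
  x<⇒y< e e≢x e≢y x<e with adjacent e e≢x e≢y
  ... | inj₁ e<x = ⊥-elim (<-asym x<e e<x)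
  ... | inj₂ y<e = y<e

  A<⇒B< : ∀ w e → w ≢ x → w ≢ y → κA w < κA e → κB w < κB e
  A<⇒B< w e w≢x w≢y w<e with e ≟ x | e ≟ y
  ... | yes refl | _        = subst₂ _<_ (sym (κB-else w w≢x w≢y)) (sym κB-x) (<-trans w<e x<y)
  ... | no _     | yes refl = subst₂ _<_ (sym (κB-else w w≢x w≢y)) (sym κB-y) (<y⇒<x w w≢x w≢y w<e)
  ... | no e≢x   | no e≢y   = subst₂ _<_ (sym (κB-else w w≢x w≢y)) (sym (κB-else e e≢x e≢y)) w<e

  B<⇒A< : ∀ w e → w ≢ x → w ≢ y → κB w < κB e → κA w < κA e
  B<⇒A< w e w≢x w≢y w<e with e ≟ x | e ≟ y
  ... | yes refl | _        = <y⇒<x w w≢x w≢y (subst₂ _<_ (κB-else w w≢x w≢y) κB-x w<e)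
  ... | no _     | yes refl = <-trans (subst₂ _<_ (κB-else w w≢x w≢y) κB-y w<e) x<y
  ... | no e≢x   | no e≢y   = subst₂ _<_ (κB-else w w≢x w≢y) (κB-else e e≢x e≢y) w<e

  y<⇒y<-B : ∀ z → κA y < κA z → κB y < κB z
  y<⇒y<-B z y<z = subst₂ _<_ (sym κB-y) (sym (κB-else z z≢x z≢y)) (<-trans x<y y<z)
    where
    z≢x : z ≢ x
    z≢x refl = <-asym x<y y<z
    z≢y : z ≢ y
    z≢y refl = <-irrefl refl y<z

  x<⇒x<-B : ∀ z → z ≢ x → z ≢ y → κA x < κA z → κB x < κB z
  x<⇒x<-B z z≢x z≢y x<z = subst₂ _<_ (sym κB-x) (sym (κB-else z z≢x z≢y)) (x<⇒y< z z≢x z≢y x<z)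

  record Swapped (T U : Tab L) (k : Kind) (ℓ p : ℕ) : Set where
    field
      x-at   : at T (cell k ℓ p) ≡ just x
      y-at   : at T (cell k ℓ (suc p)) ≡ just y
      y-at′  : at U (cell k ℓ p) ≡ just y
      x-at′  : at U (cell k ℓ (suc p)) ≡ just x
      others : ∀ c → c ≢ cell k ℓ p → c ≢ cell k ℓ (suc p) → at U c ≡ at T c
  open Swapped

  Related : Tab L → Tab L → Set
  Related T U = (T ≈ U) ⊎ (Σ Kind λ k → Σ ℕ λ ℓ → Σ ℕ λ p → Swapped T U k ℓ p)

  Simulated : Tab L → ℕ → L → Tab L → Cell → Tab L → Set
  Simulated T ℓ w T₁ c U = Σ (Tab L) λ U₁ → IB.Ins U ℓ w U₁ c × Related T₁ U₁

  Swapped-entry : ∀ {T U k ℓ p w} → Swapped T U k ℓ p → w ≢ x → w ≢ y → ∀ c e → at T c ≡ just e →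
                  Σ L λ e′ → (at U c ≡ just e′) × (κB w < κB e′ → κA w < κA e) × (κA w < κA e → κB w < κB e′)
  Swapped-entry {k = k} {ℓ} {p} {w} s w≢x w≢y c e ee with c ≟ᶜ cell k ℓ p | c ≟ᶜ cell k ℓ (suc p)
  ... | yes refl | _ with ≡just-unique ee (x-at s)
  ...   | refl = y , y-at′ s , subst₂ _<_ (κB-else w w≢x w≢y) κB-y , subst₂ _<_ (sym (κB-else w w≢x w≢y)) (sym κB-y)
  Swapped-entry {k = k} {ℓ} {p} {w} s w≢x w≢y c e ee | no _ | yes refl with ≡just-unique ee (y-at s)
  ...   | refl = x , x-at′ s , subst₂ _<_ (κB-else w w≢x w≢y) κB-x , subst₂ _<_ (sym (κB-else w w≢x w≢y)) (sym κB-x)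
  Swapped-entry s w≢x w≢y c e ee | no c≢₁ | no c≢₂ =
    e , trans (others s c c≢₁ c≢₂) ee , B<⇒A< _ e w≢x w≢y , A<⇒B< _ e w≢x w≢y

  Swapped-vacant : ∀ {T U k ℓ p} → Swapped T U k ℓ p → ∀ c → at T c ≡ nothing → at U c ≡ nothing
  Swapped-vacant {k = k} {ℓ} {p} s c empty with c ≟ᶜ cell k ℓ p | c ≟ᶜ cell k ℓ (suc p)
  ... | yes refl | _ with trans (sym empty) (x-at s)
  ...   | ()
  Swapped-vacant {k = k} {ℓ} {p} s c empty | no _ | yes refl with trans (sym empty) (y-at s)
  ...   | ()
  Swapped-vacant s c empty | no c≢₁ | no c≢₂ = trans (others s c c≢₁ c≢₂) empty

  Swapped-upd : ∀ {T U k ℓ p} → Swapped T U k ℓ p → ∀ c w → c ≢ cell k ℓ p → c ≢ cell k ℓ (suc p) →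
                Swapped (upd T c w) (upd U c w) k ℓ p
  Swapped-upd {T} {U} {k} {ℓ} {p} s c w c≢₁ c≢₂ = record
    { x-at   = trans (at-upd-≢ T c w (λ e → c≢₁ (sym e))) (x-at s)
    ; y-at   = trans (at-upd-≢ T c w (λ e → c≢₂ (sym e))) (y-at s)
    ; y-at′  = trans (at-upd-≢ U c w (λ e → c≢₁ (sym e))) (y-at′ s)
    ; x-at′  = trans (at-upd-≢ U c w (λ e → c≢₂ (sym e))) (x-at′ s)
    ; others = others′ }
    where
    others′ : ∀ d → d ≢ cell k ℓ p → d ≢ cell k ℓ (suc p) → at (upd U c w) d ≡ at (upd T c w) d
    others′ d d≢₁ d≢₂ with d ≟ᶜ c
    ... | yes refl = trans (at-upd-≡ U c w) (sym (at-upd-≡ T c w))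
    ... | no d≢c   = trans (at-upd-≢ U c w d≢c) (trans (others s d d≢₁ d≢₂) (sym (at-upd-≢ T c w d≢c)))

  vacant-≢-swapped : ∀ {T U k ℓ p} → Swapped T U k ℓ p → ∀ c → at T c ≡ nothing →
                     (c ≢ cell k ℓ p) × (c ≢ cell k ℓ (suc p))
  vacant-≢-swapped s c empty = (λ { refl → case (trans (sym empty) (x-at s)) }) , (λ { refl → case (trans (sym empty) (y-at s)) })
    where
    case : ∀ {a : L} → nothing ≡ just a → ⊥
    case ()

  Before-A⇒B : ∀ {T U k ℓ p w} → w ≢ x → w ≢ y → T ≈ U → A.Before T k ℓ p w → B.Before U k ℓ p w
  Before-A⇒B w≢x w≢y T≈U before = B.mkBefore λ q q<p →
    let e , ee , w≮e = A.passed before q q<p in e , trans (T≈U _) ee , λ w<e → w≮e (B<⇒A< _ e w≢x w≢y w<e)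

  Before-A⇒B-swapped : ∀ {T U k₀ ℓ₀ p₀ k ℓ p w} → Swapped T U k₀ ℓ₀ p₀ → w ≢ x → w ≢ y →
                       A.Before T k ℓ p w → B.Before U k ℓ p w
  Before-A⇒B-swapped s w≢x w≢y before = B.mkBefore λ q q<p →
    let e , ee , w≮e = A.passed before q q<p
        e′ , ee′ , B⇒A , _ = Swapped-entry s w≢x w≢y _ e ee
    in e′ , ee′ , λ w<e′ → w≮e (B⇒A w<e′)

  Before-A⇒B-x : ∀ {T U k ℓ p} → T ≈ U → A.Fresh T x → A.Before T k ℓ p x → B.Before U k ℓ p x
  Before-A⇒B-x {T} {U} {k} {ℓ} {p} T≈U fresh before = B.mkBefore pass
    where
    pass : ∀ q → q < p → Σ L λ e → (at U (cell k ℓ q) ≡ just e) × ¬ (κB x < κB e)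
    pass q q<p with A.passed before q q<p
    ... | e , ee , x≮e = e , trans (T≈U _) ee , λ x<e → <-asym (<-trans e<x x<y) (subst₂ _<_ κB-x (κB-else e e≢x e≢y) x<e)
      where
      e≢x : e ≢ x
      e≢x refl = fresh _ ee
      e≢y : e ≢ y
      e≢y refl = x≮e x<y
      e<x : κA e < κA x
      e<x = A.κ-≯∧≢⇒< e x x≮e e≢x

  Before-A⇒B-y : ∀ {T U k ℓ p} → T ≈ U → A.Fresh T y → (∀ q → q < p → at T (cell k ℓ q) ≢ just x) →
                 A.Before T k ℓ p y → B.Before U k ℓ p y
  Before-A⇒B-y {T} {U} {k} {ℓ} {p} T≈U fresh no-x before = B.mkBefore pass
    where
    pass : ∀ q → q < p → Σ L λ e → (at U (cell k ℓ q) ≡ just e) × ¬ (κB y < κB e)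
    pass q q<p with A.passed before q q<p
    ... | e , ee , y≮e = e , trans (T≈U _) ee ,
                         λ y<e → <-asym (<y⇒<x e e≢x e≢y (A.κ-≯∧≢⇒< e y y≮e e≢y)) (subst₂ _<_ κB-y (κB-else e e≢x e≢y) y<e)
      where
      e≢x : e ≢ x
      e≢x refl = no-x q q<p ee
      e≢y : e ≢ y
      e≢y refl = fresh _ ee

  find-x : ∀ (T : Tab L) k ℓ p → (Σ ℕ λ q → (q < p) × (at T (cell k ℓ q) ≡ just x)) ⊎ (∀ q → q < p → at T (cell k ℓ q) ≢ just x)
  find-x T k ℓ zero = inj₂ (λ q ())
  find-x T k ℓ (suc p) with find-x T k ℓ p
  ... | inj₁ (q , q<p , ex) = inj₁ (q , m<n⇒m<1+n q<p , ex)
  ... | inj₂ none with ≡-dec _≟_ (at T (cell k ℓ p)) (just x)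
  ...   | yes ex = inj₁ (p , ≤-refl , ex)
  ...   | no ¬ex = inj₂ none′
    where
    none′ : ∀ q → q < suc p → at T (cell k ℓ q) ≢ just x
    none′ q q<1+p with m≤n⇒m<n∨m≡n (≤-pred q<1+p)
    ... | inj₁ q<p  = none q q<p
    ... | inj₂ refl = ¬ex

  cell-y≡cell-x : ∀ a b → cell (kind y) a b ≡ cell (kind x) b a
  cell-y≡cell-x a b = trans (cong (λ k → cell k a b) kind-y) (cell-other (kind x) a b)

  lineOf-y-cell-x : ∀ a b → lineOf (kind y) (cell (kind x) a b) ≡ b
  lineOf-y-cell-x a b = trans (cong (λ k → lineOf k (cell (kind x) a b)) kind-y) (lineOf-other-cell (kind x) a b)

  lineOf-x-cell-y : ∀ a b → lineOf (kind x) (cell (kind y) a b) ≡ b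
  lineOf-x-cell-y a b = trans (cong (lineOf (kind x)) (cell-y≡cell-x a b)) (lineOf-cell (kind x) b a)

  -- The cell before the y of a swapped pair holds x, which w has already passed.
  cannot-bump-swapped-y : ∀ {T U ℓ w p k₀ ℓ₀ p₀} → A.IsTableau T → A.Pending T (kind w) ℓ w → w ≢ x → w ≢ y →
                          A.Before T (kind w) ℓ p w → κA w < κA y → Swapped T U k₀ ℓ₀ p₀ →
                          cell (kind w) ℓ p ≡ cell k₀ ℓ₀ (suc p₀) → ⊥
  cannot-bump-swapped-y {T} {w = w} {k₀ = k₀} isT pend w≢x w≢y before w<y s e with same-or-other (kind w) k₀
  ... | inj₁ refl with cell-injective (kind w) e
  ...   | refl , refl = between (A.Before-< (A.fresh pend) before _ x ≤-refl (x-at s))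
    where
    between : κA x < κA w → ⊥
    between x<w with adjacent w w≢x w≢y
    ... | inj₁ w<x = <-asym x<w w<x
    ... | inj₂ y<w = <-asym w<y y<w
  cannot-bump-swapped-y {T} {w = w} {k₀ = k₀} {ℓ₀} {p₀} isT pend w≢x w≢y before w<y s e | inj₂ refl
    with cell-injective (kind w) (trans e (cell-other (kind w) ℓ₀ (suc p₀)))
  ... | refl , refl = between (A.earlier-line-< isT pend before p₀ x ≤-refl
                                  (trans (cong (at T) (sym (cell-other (kind w) ℓ₀ p₀))) (x-at s)))
    where
    between : κA x < κA w → ⊥
    between x<w with adjacent w w≢x w≢y
    ... | inj₁ w<x = <-asym x<w w<x
    ... | inj₂ y<w = <-asym w<y y<w

  -- Whatever follows x on a line exceeds y, so a y that has passed x stops right behind it.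
  stops-right-after-x : ∀ {T ℓ p q} → A.IsTableau T → A.Fresh T y → A.Before T (kind y) ℓ p y → q < p →
                        at T (cell (kind y) ℓ q) ≡ just x → p ≡ suc q
  stops-right-after-x {T} {ℓ} {p} {q} isT fresh before q<p ex with m≤n⇒m<n∨m≡n q<p
  ... | inj₂ 1+q≡p = sym 1+q≡p
  ... | inj₁ 1+q<p with A.passed before (suc q) 1+q<p
  ...   | e , ee , y≮e = ⊥-elim (y≮e (x<⇒y< e e≢x e≢y x<e))
    where
    x<e : κA x < κA e
    x<e = A.increasing isT (kind y) ℓ q (suc q) x e ≤-refl ex ee
    e≢x : e ≢ x
    e≢x refl = <-irrefl refl x<e
    e≢y : e ≢ y
    e≢y refl = fresh _ ee

  record Invariant (T U : Tab L) (ℓ : ℕ) (w : L) : Set where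
    constructor invariant
    field
      isTableauA : A.IsTableau T
      pendingA   : A.Pending T (kind w) ℓ w
      isTableauB : B.IsTableau U
      pendingB   : B.Pending U (kind w) ℓ w
  open Invariant

  invariant-after : ∀ {T U ℓ w p z ℓ₁} → Invariant T U ℓ w →
                    A.Before T (kind w) ℓ p w → at T (cell (kind w) ℓ p) ≡ just z → κA w < κA z →
                    B.Before U (kind w) ℓ p w → at U (cell (kind w) ℓ p) ≡ just z → κB w < κB z →
                    ℓ₁ ≡ suc (lineOf (kind z) (cell (kind w) ℓ p)) →
                    Invariant (upd T (cell (kind w) ℓ p) w) (upd U (cell (kind w) ℓ p) w) ℓ₁ z
  invariant-after {z = z} inv beforeA atzA w<zA beforeB atzB w<zB refl =
    let isA , pendA = A.bump-preserves (isTableauA inv) (pendingA inv) beforeA atzA w<zA (kind z)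
        isB , pendB = B.bump-preserves (isTableauB inv) (pendingB inv) beforeB atzB w<zB (kind z)
    in invariant isA pendA isB pendB

  -- In A, y passes x at position q of its line and stops at q+1.  In B, y bumps that x instead,
  -- and x, entering its next line at position ℓ, lands exactly on the cell where A's y stopped.
  module YPassesX {T U : Tab L} {ℓ q : ℕ} (before : A.Before T (kind y) ℓ (suc q) y)
                  (ex : at T (cell (kind y) ℓ q) ≡ just x) (inv : Invariant T U ℓ y) (T≈U : T ≈ U) where

    private
      isT : A.IsTableau T
      isT = isTableauA inv
      pend : A.Pending T (kind y) ℓ y
      pend = pendingA inv

    cx : Cell
    cx = cell (kind y) ℓ q

    cs : Cell
    cs = cell (kind y) ℓ (suc q)

    before-x : B.Before U (kind y) ℓ q y
    before-x = B.mkBefore pass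
      where
      pass : ∀ r → r < q → Σ L λ e → (at U (cell (kind y) ℓ r) ≡ just e) × ¬ (κB y < κB e)
      pass r r<q with A.passed before r (m<n⇒m<1+n r<q)
      ... | e , ee , y≮e = e , trans (T≈U _) ee ,
                           λ y<e → <-asym (<y⇒<x e e≢x e≢y (A.κ-≯∧≢⇒< e y y≮e e≢y)) (subst₂ _<_ κB-y (κB-else e e≢x e≢y) y<e)
        where
        e≢x : e ≢ x
        e≢x refl = <-irrefl (proj₂ (cell-injective (kind y) (A.distinct isT _ _ x ee ex))) r<q
        e≢y : e ≢ y
        e≢y refl = A.fresh pend _ ee

    x-atU : at U cx ≡ just x
    x-atU = trans (T≈U cx) ex

    bumpedU : B.IsTableau (upd U cx y) × B.Pending (upd U cx y) (kind x) (suc (lineOf (kind x) cx)) x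
    bumpedU = B.bump-preserves (isTableauB inv) (pendingB inv) before-x x-atU y<x-B (kind x)

    ℓx : ℕ
    ℓx = suc (lineOf (kind x) cx)

    cq : Cell
    cq = cell (kind x) ℓx ℓ

    cq≡cs : cq ≡ cs
    cq≡cs = trans (cong (λ m → cell (kind x) (suc m) ℓ) (lineOf-x-cell-y ℓ q)) (sym (cell-y≡cell-x ℓ (suc q)))

    cx≢cs : cx ≢ cs
    cx≢cs e = 1+n≢n (sym (proj₂ (cell-injective (kind y) e)))

    cx≢cq : cx ≢ cq
    cx≢cq e = cx≢cs (trans e cq≡cs)

    U₁ : Tab L
    U₁ = upd U cx y

    -- The entries x passes on its new line lie on earlier lines of y's scan, below y and hence below x.
    before-cq : B.Before U₁ (kind x) ℓx ℓ x
    before-cq = B.mkBefore pass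
      where
      pass : ∀ r → r < ℓ → Σ L λ e → (at U₁ (cell (kind x) ℓx r) ≡ just e) × ¬ (κB x < κB e)
      pass r r<ℓ with A.earlier-line-filled isT pend before r r<ℓ
      ... | a , ea , a<y = a , trans (at-upd-≢ U cx y cr≢cx) (trans (cong (at U) cr≡) (trans (T≈U _) ea)) , x≮a
        where
        cr≡ : cell (kind x) ℓx r ≡ cell (kind y) r (suc q)
        cr≡ = trans (cong (λ m → cell (kind x) (suc m) r) (lineOf-x-cell-y ℓ q)) (sym (cell-y≡cell-x r (suc q)))
        cr≢cx : cell (kind x) ℓx r ≢ cx
        cr≢cx e = 1+n≢n (proj₂ (cell-injective (kind y) (trans (sym cr≡) e)))
        a≢y : a ≢ y
        a≢y refl = A.fresh pend _ ea
        a≢x : a ≢ x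
        a≢x refl = 1+n≢n (proj₂ (cell-injective (kind y) (A.distinct isT _ _ x ea ex)))
        x≮a : ¬ (κB x < κB a)
        x≮a x<a = <-asym (<-trans (<y⇒<x a a≢x a≢y a<y) x<y) (subst₂ _<_ κB-x (κB-else a a≢x a≢y) x<a)

    at-cq : ∀ {m} → at T cs ≡ m → at U₁ cq ≡ m
    at-cq e = trans (at-upd-≢ U cx y (λ e₂ → cx≢cq (sym e₂))) (trans (cong (at U) cq≡cs) (trans (T≈U cs) e))

    swapped : Swapped (upd T cs y) (upd U₁ cq x) (kind y) ℓ q
    swapped = record
      { x-at   = trans (at-upd-≢ T cs y cx≢cs) ex
      ; y-at   = at-upd-≡ T cs y
      ; y-at′  = trans (at-upd-≢ U₁ cq x cx≢cq) (at-upd-≡ U cx y)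
      ; x-at′  = at-upd-≡′ U₁ cq x (sym cq≡cs)
      ; others = others′ }
      where
      others′ : ∀ d → d ≢ cx → d ≢ cs → at (upd U₁ cq x) d ≡ at (upd T cs y) d
      others′ d d≢cx d≢cs = trans (at-upd-≢ U₁ cq x (λ e → d≢cs (trans e cq≡cs)))
                              (trans (at-upd-≢ U cx y d≢cx) (trans (T≈U d) (sym (at-upd-≢ T cs y d≢cs))))

    x<z-B : ∀ {z} → at T cs ≡ just z → κA y < κA z → κB x < κB z
    x<z-B {z} atz y<z = x<⇒x<-B z z≢x z≢y (<-trans x<y y<z)
      where
      z≢x : z ≢ x
      z≢x refl = <-asym x<y y<z
      z≢y : z ≢ y
      z≢y refl = A.fresh pend _ atz

    next-invariant : ∀ {z} → at T cs ≡ just z → κA y < κA z →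
                     Invariant (upd T cs y) (upd U₁ cq x) (suc (lineOf (kind z) cs)) z
    next-invariant {z} atz y<z =
      let isA , pendA = A.bump-preserves isT pend before atz y<z (kind z)
          isB , pendB = B.bump-preserves (proj₁ bumpedU) (proj₂ bumpedU) before-cq (at-cq atz) (x<z-B atz y<z) (kind z)
      in invariant isA pendA isB (subst (λ m → B.Pending (upd U₁ cq x) (kind z) m z) (cong (λ d → suc (lineOf (kind z) d)) cq≡cs) pendB)

  -- In A, x bumps the y at cs and y, entering its next line at position ℓ, stops at the cell cn right
  -- behind cs.  In B, x passes that y and stops at cn itself; afterwards x and y sit swapped.
  module XBumpsY {T U : Tab L} {ℓ p : ℕ} (before : A.Before T (kind x) ℓ p x)
                 (aty : at T (cell (kind x) ℓ p) ≡ just y) (inv : Invariant T U ℓ x) (T≈U : T ≈ U) where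

    cs : Cell
    cs = cell (kind x) ℓ p

    cn : Cell
    cn = cell (kind x) ℓ (suc p)

    ℓy : ℕ
    ℓy = suc (lineOf (kind y) cs)

    cc : ℕ → Cell
    cc q = cell (kind y) ℓy q

    cc≡ : ∀ q → cc q ≡ cell (kind x) q (suc p)
    cc≡ q = trans (cong (λ m → cell (kind y) (suc m) q) (lineOf-y-cell-x ℓ p)) (cell-y≡cell-x (suc p) q)

    cs≢cc : ∀ q → cs ≢ cc q
    cs≢cc q e = 1+n≢n (sym (proj₂ (cell-injective (kind x) (trans e (cc≡ q)))))

    cs≢cn : cs ≢ cn
    cs≢cn e = 1+n≢n (sym (proj₂ (cell-injective (kind x) e)))

    before-cnB : B.Before U (kind x) ℓ (suc p) x
    before-cnB = B.mkBefore pass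
      where
      pass : ∀ q → q < suc p → Σ L λ e → (at U (cell (kind x) ℓ q) ≡ just e) × ¬ (κB x < κB e)
      pass q q<1+p with m≤n⇒m<n∨m≡n (≤-pred q<1+p)
      ... | inj₁ q<p  = B.passed (Before-A⇒B-x T≈U (A.fresh (pendingA inv)) before) q q<p
      ... | inj₂ refl = y , trans (T≈U _) aty , λ x<y-B → <-asym x<y-B y<x-B

    before-y : A.Before (upd T cs x) (kind y) ℓy ℓ y
    before-y = A.mkBefore pass
      where
      pass : ∀ q → q < ℓ → Σ L λ e → (at (upd T cs x) (cc q) ≡ just e) × ¬ (κA y < κA e)
      pass q q<ℓ with B.earlier-line-filled (isTableauB inv) (pendingB inv) before-cnB q q<ℓ
      ... | a , ea , a<x = a , trans (at-upd-≢ T cs x (λ e → cs≢cc q (sym e))) (trans (cong (at T) (cc≡ q)) ea₁) , y≮a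
        where
        ea₁ : at T (cell (kind x) q (suc p)) ≡ just a
        ea₁ = trans (sym (T≈U _)) ea
        a≢x : a ≢ x
        a≢x refl = A.fresh (pendingA inv) _ ea₁
        a≢y : a ≢ y
        a≢y refl = cs≢cc q (trans (A.distinct (isTableauA inv) cs _ y aty ea₁) (sym (cc≡ q)))
        y≮a : ¬ (κA y < κA a)
        y≮a y<a = <-asym y<a (subst₂ _<_ (κB-else a a≢x a≢y) κB-x a<x)

    bumpedA : A.IsTableau (upd T cs x) × A.Pending (upd T cs x) (kind y) ℓy y
    bumpedA = A.bump-preserves (isTableauA inv) (pendingA inv) before aty x<y (kind y)

    at-cc : ∀ {m} → at T cn ≡ m → at (upd T cs x) (cc ℓ) ≡ m
    at-cc e = trans (at-upd-≢ T cs x (λ e₂ → cs≢cc ℓ (sym e₂))) (trans (cong (at T) (cc≡ ℓ)) e)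

    y<next : ∀ {e} → at T cn ≡ just e → κA y < κA e
    y<next at-cn = A.increasing (isTableauA inv) (kind x) ℓ p (suc p) y _ ≤-refl aty at-cn

    x<next-B : ∀ {e} → at T cn ≡ just e → κB x < κB e
    x<next-B {e} at-cn = x<⇒x<-B e e≢x e≢y (<-trans x<y (y<next at-cn))
      where
      e≢x : e ≢ x
      e≢x refl = A.fresh (pendingA inv) _ at-cn
      e≢y : e ≢ y
      e≢y refl = cs≢cn (A.distinct (isTableauA inv) cs cn y aty at-cn)

    cc≡cn : cc ℓ ≡ cn
    cc≡cn = cc≡ ℓ

    swapped : Swapped (upd (upd T cs x) (cc ℓ) y) (upd U cn x) (kind x) ℓ p
    swapped = record
      { x-at   = trans (at-upd-≢ (upd T cs x) (cc ℓ) y (cs≢cc ℓ)) (at-upd-≡ T cs x)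
      ; y-at   = at-upd-≡′ (upd T cs x) (cc ℓ) y (sym (cc≡ ℓ))
      ; y-at′  = trans (at-upd-≢ U cn x cs≢cn) (trans (T≈U cs) aty)
      ; x-at′  = at-upd-≡ U cn x
      ; others = others′ }
      where
      others′ : ∀ d → d ≢ cs → d ≢ cn → at (upd U cn x) d ≡ at (upd (upd T cs x) (cc ℓ) y) d
      others′ d d≢cs d≢cn = trans (at-upd-≢ U cn x d≢cn)
        (trans (T≈U d) (sym (trans (at-upd-≢ (upd T cs x) (cc ℓ) y (λ e → d≢cn (trans e (cc≡ ℓ)))) (at-upd-≢ T cs x d≢cs))))

    next-invariant : ∀ {e} → at T cn ≡ just e →
                     Invariant (upd (upd T cs x) (cc ℓ) y) (upd U cn x) (suc (lineOf (kind e) (cc ℓ))) e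
    next-invariant {e} at-cn =
      let isA , pendA = A.bump-preserves (proj₁ bumpedA) (proj₂ bumpedA) before-y (at-cc at-cn) (y<next at-cn) (kind e)
          isB , pendB = B.bump-preserves (isTableauB inv) (pendingB inv) before-cnB (trans (T≈U cn) at-cn) (x<next-B at-cn) (kind e)
      in invariant isA pendA isB (subst (λ d → B.Pending (upd U cn x) (kind e) (suc (lineOf (kind e) d)) e) (sym cc≡cn) pendB)

  module WBumpsX {T U : Tab L} {ℓ p : ℕ} {w : L} {k₀ : Kind} {ℓ₀ p₀ : ℕ} (w≢x : w ≢ x) (w≢y : w ≢ y)
                 (before : A.Before T (kind w) ℓ p w) (atx : at T (cell (kind w) ℓ p) ≡ just x) (w<x : κA w < κA x)
                 (inv : Invariant T U ℓ w) (s : Swapped T U k₀ ℓ₀ p₀) (cs≡ : cell (kind w) ℓ p ≡ cell k₀ ℓ₀ p₀) where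

    cs : Cell
    cs = cell (kind w) ℓ p

    beforeB : B.Before U (kind w) ℓ p w
    beforeB = Before-A⇒B-swapped s w≢x w≢y before

    y-atU : at U cs ≡ just y
    y-atU = trans (cong (at U) cs≡) (y-at′ s)

    w<y-B : κB w < κB y
    w<y-B = subst₂ _<_ (sym (κB-else w w≢x w≢y)) (sym κB-y) w<x

    bumpedA : A.IsTableau (upd T cs w) × A.Pending (upd T cs w) (kind x) (suc (lineOf (kind x) cs)) x
    bumpedA = A.bump-preserves (isTableauA inv) (pendingA inv) before atx w<x (kind x)

    bumpedB : B.IsTableau (upd U cs w) × B.Pending (upd U cs w) (kind y) (suc (lineOf (kind y) cs)) y
    bumpedB = B.bump-preserves (isTableauB inv) (pendingB inv) beforeB y-atU w<y-B (kind y)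

  -- The swapped pair runs along y's direction.  In A, x moves to its next line and bumps the y there;
  -- in B, y moves on directly.  Both leave the same tableau and continue with y into the same line.
  module WBumpsXAcross {T U : Tab L} {ℓ p : ℕ} {w : L} {ℓ₀ p₀ : ℕ} (w≢x : w ≢ x) (w≢y : w ≢ y)
                       (before : A.Before T (kind w) ℓ p w) (atx : at T (cell (kind w) ℓ p) ≡ just x) (w<x : κA w < κA x)
                       (inv : Invariant T U ℓ w) (s : Swapped T U (other (kind x)) ℓ₀ p₀)
                       (cs≡ : cell (kind w) ℓ p ≡ cell (other (kind x)) ℓ₀ p₀) where
    open WBumpsX w≢x w≢y before atx w<x inv s cs≡ public

    ℓx : ℕ
    ℓx = suc (lineOf (kind x) cs)

    lineOf-x-cs : lineOf (kind x) cs ≡ p₀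
    lineOf-x-cs = trans (cong (lineOf (kind x)) (trans cs≡ (cell-other (kind x) ℓ₀ p₀))) (lineOf-cell (kind x) p₀ ℓ₀)

    lineOf-y-cs : lineOf (kind y) cs ≡ ℓ₀
    lineOf-y-cs = trans (cong (lineOf (kind y)) cs≡)
                        (trans (cong (λ k → lineOf k (cell (other (kind x)) ℓ₀ p₀)) kind-y) (lineOf-cell (other (kind x)) ℓ₀ p₀))

    cy : Cell
    cy = cell (kind x) ℓx ℓ₀

    cy≡ : cy ≡ cell (other (kind x)) ℓ₀ (suc p₀)
    cy≡ = trans (cong (λ m → cell (kind x) (suc m) ℓ₀) lineOf-x-cs) (sym (cell-other (kind x) ℓ₀ (suc p₀)))

    cs≢cy : cs ≢ cy
    cs≢cy e = 1+n≢n (sym (trans (cong (lineOf (kind x)) e) (lineOf-cell (kind x) ℓx ℓ₀)))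

    y-at-cy : at (upd T cs w) cy ≡ just y
    y-at-cy = trans (at-upd-≢ T cs w (λ e → cs≢cy (sym e))) (trans (cong (at T) cy≡) (y-at s))

    before-cy : A.Before (upd T cs w) (kind x) ℓx ℓ₀ x
    before-cy = A.mkBefore pass
      where
      pass : ∀ q → q < ℓ₀ → Σ L λ e → (at (upd T cs w) (cell (kind x) ℓx q) ≡ just e) × ¬ (κA x < κA e)
      pass q q<ℓ₀ with A.closed-≤ (isTableauA inv) (kind x) ℓx q ℓ₀ y (<⇒≤ q<ℓ₀) (trans (cong (at T) cy≡) (y-at s))
      ... | e , ee , _ = e , trans (at-upd-≢ T cs w cq≢cs) ee , x≮e
        where
        cq≢cs : cell (kind x) ℓx q ≢ cs
        cq≢cs e = 1+n≢n (trans (sym (lineOf-cell (kind x) ℓx q)) (cong (lineOf (kind x)) e))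
        e<y : κA e < κA y
        e<y = A.increasing (isTableauA inv) (kind x) ℓx q ℓ₀ e y q<ℓ₀ ee (trans (cong (at T) cy≡) (y-at s))
        e≢x : e ≢ x
        e≢x refl = cq≢cs (A.distinct (isTableauA inv) _ _ x ee atx)
        x≮e : ¬ (κA x < κA e)
        x≮e x<e = <-asym x<e (<y⇒<x e e≢x (A.κ-<⇒≢ e<y) e<y)

    stop-cy : A.Stop (upd T cs w) (kind x) ℓx ℓ₀ x
    stop-cy = A.blocked y-at-cy x<y

    line-y≡ : suc (lineOf (kind y) cs) ≡ suc (lineOf (kind y) cy)
    line-y≡ = cong suc (trans lineOf-y-cs (sym (lineOf-y-cell-x ℓx ℓ₀)))

    same-result : upd (upd T cs w) cy x ≈ upd U cs w
    same-result d with d ≟ᶜ cs | d ≟ᶜ cy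
    ... | yes refl | _ = trans (at-upd-≡ U cs w) (sym (trans (at-upd-≢ (upd T cs w) cy x cs≢cy) (at-upd-≡ T cs w)))
    ... | no d≢cs  | yes refl =
      trans (at-upd-≢ U cs w d≢cs) (trans (cong (at U) cy≡) (trans (x-at′ s) (sym (at-upd-≡ (upd T cs w) cy x))))
    ... | no d≢cs  | no d≢cy = trans (at-upd-≢ U cs w d≢cs)
      (trans (others s d (λ e → d≢cs (trans e (sym cs≡))) (λ e → d≢cy (trans e (sym cy≡))))
             (sym (trans (at-upd-≢ (upd T cs w) cy x d≢cy) (at-upd-≢ T cs w d≢cs))))

  -- The swapped pair runs along x's direction.  In A, x moves to its next line; in B, y moves to its
  -- next line, meets the swapped x right there and bumps it into that same line of x.
  module WBumpsXAlong {T U : Tab L} {ℓ p : ℕ} {w : L} {ℓ₀ p₀ : ℕ} (w≢x : w ≢ x) (w≢y : w ≢ y)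
                      (before : A.Before T (kind w) ℓ p w) (atx : at T (cell (kind w) ℓ p) ≡ just x) (w<x : κA w < κA x)
                      (inv : Invariant T U ℓ w) (s : Swapped T U (kind x) ℓ₀ p₀)
                      (cs≡ : cell (kind w) ℓ p ≡ cell (kind x) ℓ₀ p₀) where
    open WBumpsX w≢x w≢y before atx w<x inv s cs≡ public

    lineOf-x-cs : lineOf (kind x) cs ≡ ℓ₀
    lineOf-x-cs = trans (cong (lineOf (kind x)) cs≡) (lineOf-cell (kind x) ℓ₀ p₀)

    lineOf-y-cs : lineOf (kind y) cs ≡ p₀
    lineOf-y-cs = trans (cong (lineOf (kind y)) cs≡) (lineOf-y-cell-x ℓ₀ p₀)

    ℓy : ℕ
    ℓy = suc (lineOf (kind y) cs)

    cx : Cell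
    cx = cell (kind y) ℓy ℓ₀

    cx≡ : cx ≡ cell (kind x) ℓ₀ (suc p₀)
    cx≡ = trans (cong (λ m → cell (kind y) (suc m) ℓ₀) lineOf-y-cs) (cell-y≡cell-x (suc p₀) ℓ₀)

    cs≢cx : cs ≢ cx
    cs≢cx e = 1+n≢n (sym (trans (cong (lineOf (kind y)) e) (lineOf-cell (kind y) ℓy ℓ₀)))

    x-at-cx : at (upd U cs w) cx ≡ just x
    x-at-cx = trans (at-upd-≢ U cs w (λ e → cs≢cx (sym e))) (trans (cong (at U) cx≡) (x-at′ s))

    before-cx : B.Before (upd U cs w) (kind y) ℓy ℓ₀ y
    before-cx = B.mkBefore pass
      where
      pass : ∀ q → q < ℓ₀ → Σ L λ e → (at (upd U cs w) (cell (kind y) ℓy q) ≡ just e) × ¬ (κB y < κB e)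
      pass q q<ℓ₀ with B.closed-≤ (isTableauB inv) (kind y) ℓy q ℓ₀ x (<⇒≤ q<ℓ₀) (trans (cong (at U) cx≡) (x-at′ s))
      ... | e , ee , _ = e , trans (at-upd-≢ U cs w cq≢cs) ee , y≮e
        where
        cq≢cs : cell (kind y) ℓy q ≢ cs
        cq≢cs e = 1+n≢n (trans (sym (lineOf-cell (kind y) ℓy q)) (cong (lineOf (kind y)) e))
        e<x : κB e < κB x
        e<x = B.increasing (isTableauB inv) (kind y) ℓy q ℓ₀ e x q<ℓ₀ ee (trans (cong (at U) cx≡) (x-at′ s))
        e≢x : e ≢ x
        e≢x refl = <-irrefl refl e<x
        e≢y : e ≢ y
        e≢y refl = cq≢cs (B.distinct (isTableauB inv) _ _ y ee y-atU)
        y≮e : ¬ (κB y < κB e)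
        y≮e y<e = <-asym (<y⇒<x e e≢x e≢y (subst₂ _<_ (κB-else e e≢x e≢y) κB-x e<x)) (subst₂ _<_ κB-y (κB-else e e≢x e≢y) y<e)

    bumpedB₂ : B.IsTableau (upd (upd U cs w) cx y) × B.Pending (upd (upd U cs w) cx y) (kind x) (suc (lineOf (kind x) cx)) x
    bumpedB₂ = B.bump-preserves (proj₁ bumpedB) (proj₂ bumpedB) before-cx x-at-cx y<x-B (kind x)

    line-x≡ : suc (lineOf (kind x) cx) ≡ suc (lineOf (kind x) cs)
    line-x≡ = cong suc (trans (cong (lineOf (kind x)) cx≡) (trans (lineOf-cell (kind x) ℓ₀ (suc p₀)) (sym lineOf-x-cs)))

    same-result : upd T cs w ≈ upd (upd U cs w) cx y
    same-result d with d ≟ᶜ cs | d ≟ᶜ cx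
    ... | yes refl | _ = trans (at-upd-≢ (upd U cs w) cx y cs≢cx) (trans (at-upd-≡ U cs w) (sym (at-upd-≡ T cs w)))
    ... | no d≢cs  | yes refl =
      trans (at-upd-≡ (upd U cs w) cx y) (sym (trans (at-upd-≢ T cs w d≢cs) (trans (cong (at T) cx≡) (y-at s))))
    ... | no d≢cs  | no d≢cx = trans (at-upd-≢ (upd U cs w) cx y d≢cx) (trans (at-upd-≢ U cs w d≢cs)
      (trans (others s d (λ e → d≢cs (trans e (sym cs≡))) (λ e → d≢cx (trans e (sym cx≡)))) (sym (at-upd-≢ T cs w d≢cs))))


  simulate-new-other : ∀ {T U ℓ w p} → w ≢ x → w ≢ y → A.Before T (kind w) ℓ p w → at T (cell (kind w) ℓ p) ≡ nothing →
                       Related T U → Simulated T ℓ w (upd T (cell (kind w) ℓ p) w) (cell (kind w) ℓ p) U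
  simulate-new-other {U = U} {ℓ} {w} {p} w≢x w≢y before empty (inj₁ T≈U) =
    upd U (cell (kind w) ℓ p) w , IB.new refl (Before-A⇒B w≢x w≢y T≈U before) (trans (T≈U _) empty) ,
    inj₁ (upd-≈ (cell (kind w) ℓ p) w T≈U)
  simulate-new-other {U = U} {ℓ} {w} {p} w≢x w≢y before empty (inj₂ (k₀ , ℓ₀ , p₀ , s)) =
    upd U (cell (kind w) ℓ p) w , IB.new refl (Before-A⇒B-swapped s w≢x w≢y before) (Swapped-vacant s _ empty) ,
    inj₂ (k₀ , ℓ₀ , p₀ , Swapped-upd s _ w (proj₁ (vacant-≢-swapped s _ empty)) (proj₂ (vacant-≢-swapped s _ empty)))

  simulate-new-x : ∀ {T U ℓ p} → A.Before T (kind x) ℓ p x → at T (cell (kind x) ℓ p) ≡ nothing →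
                   Invariant T U ℓ x → Related T U → Simulated T ℓ x (upd T (cell (kind x) ℓ p) x) (cell (kind x) ℓ p) U
  simulate-new-x before empty inv (inj₂ (_ , _ , _ , s)) = ⊥-elim (A.fresh (pendingA inv) _ (x-at s))
  simulate-new-x {U = U} {ℓ} {p} before empty inv (inj₁ T≈U) =
    upd U (cell (kind x) ℓ p) x , IB.new refl (Before-A⇒B-x T≈U (A.fresh (pendingA inv)) before) (trans (T≈U _) empty) ,
    inj₁ (upd-≈ (cell (kind x) ℓ p) x T≈U)

  simulate-new-y : ∀ {T U ℓ p} → A.Before T (kind y) ℓ p y → at T (cell (kind y) ℓ p) ≡ nothing →
                   Invariant T U ℓ y → Related T U → Simulated T ℓ y (upd T (cell (kind y) ℓ p) y) (cell (kind y) ℓ p) U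
  simulate-new-y before empty inv (inj₂ (_ , _ , _ , s)) = ⊥-elim (A.fresh (pendingA inv) _ (y-at s))
  simulate-new-y {T} {U} {ℓ} {p} before empty inv (inj₁ T≈U) with find-x T (kind y) ℓ p
  ... | inj₁ (q , q<p , ex) with stops-right-after-x (isTableauA inv) (A.fresh (pendingA inv)) before q<p ex
  ...   | refl = upd U₁ cq x ,
                 IB.bump refl before-x x-atU y<x-B (subst (IB.Ins U₁ ℓx x (upd U₁ cq x)) cq≡cs (IB.new refl before-cq (at-cq empty))) ,
                 inj₂ (kind y , ℓ , q , swapped)
    where open YPassesX before ex inv T≈U
  simulate-new-y {T} {U} {ℓ} {p} before empty inv (inj₁ T≈U) | inj₂ no-x =
    upd U (cell (kind y) ℓ p) y , IB.new refl (Before-A⇒B-y T≈U (A.fresh (pendingA inv)) no-x before) (trans (T≈U _) empty) ,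
    inj₁ (upd-≈ (cell (kind y) ℓ p) y T≈U)

  mutual
    simulate : ∀ {T U ℓ w T₁ c} → IA.Ins T ℓ w T₁ c → Invariant T U ℓ w → Related T U → Simulated T ℓ w T₁ c U
    simulate {w = w} (IA.bump refl before atz w<z D) inv rel with w ≟ x | w ≟ y
    ... | yes refl | _        = simulate-bump-x before atz w<z D inv rel
    ... | no _     | yes refl = simulate-bump-y before atz w<z D inv rel
    ... | no w≢x   | no w≢y   = simulate-bump-other w≢x w≢y before atz w<z D inv rel
    simulate {w = w} (IA.new refl before empty) inv rel with w ≟ x | w ≟ y
    ... | yes refl | _        = simulate-new-x before empty inv rel
    ... | no _     | yes refl = simulate-new-y before empty inv rel
    ... | no w≢x   | no w≢y   = simulate-new-other w≢x w≢y before empty rel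

    same-bump : ∀ {T U ℓ w p z T₁ c} → Invariant T U ℓ w →
                A.Before T (kind w) ℓ p w → at T (cell (kind w) ℓ p) ≡ just z → κA w < κA z →
                B.Before U (kind w) ℓ p w → at U (cell (kind w) ℓ p) ≡ just z → κB w < κB z →
                Related (upd T (cell (kind w) ℓ p) w) (upd U (cell (kind w) ℓ p) w) →
                IA.Ins (upd T (cell (kind w) ℓ p) w) (suc (lineOf (kind z) (cell (kind w) ℓ p))) z T₁ c →
                Simulated T ℓ w T₁ c U
    same-bump inv beforeA atzA w<zA beforeB atzB w<zB rel D =
      let U₁ , DB , rel₁ = simulate D (invariant-after inv beforeA atzA w<zA beforeB atzB w<zB refl) rel
      in U₁ , IB.bump refl beforeB atzB w<zB DB , rel₁

    simulate-bump-other : ∀ {T U ℓ w p z T₁ c} → w ≢ x → w ≢ y →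
                          A.Before T (kind w) ℓ p w → at T (cell (kind w) ℓ p) ≡ just z → κA w < κA z →
                          IA.Ins (upd T (cell (kind w) ℓ p) w) (suc (lineOf (kind z) (cell (kind w) ℓ p))) z T₁ c →
                          Invariant T U ℓ w → Related T U → Simulated T ℓ w T₁ c U
    simulate-bump-other {ℓ = ℓ} {w} {p} w≢x w≢y before atz w<z D inv (inj₁ T≈U) =
      same-bump inv before atz w<z (Before-A⇒B w≢x w≢y T≈U before) (trans (T≈U _) atz) (A<⇒B< w _ w≢x w≢y w<z)
                (inj₁ (upd-≈ (cell (kind w) ℓ p) w T≈U)) D
    simulate-bump-other {T} {ℓ = ℓ} {w} {p} w≢x w≢y before atz w<z D inv (inj₂ (k₀ , ℓ₀ , p₀ , s))
      with cell (kind w) ℓ p ≟ᶜ cell k₀ ℓ₀ p₀ | cell (kind w) ℓ p ≟ᶜ cell k₀ ℓ₀ (suc p₀)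
    ... | yes cs≡ | _ with ≡just-unique (trans (cong (at T) (sym cs≡)) atz) (x-at s)
    ...   | refl = simulate-bump-swapped-x w≢x w≢y before atz w<z D inv s cs≡
    simulate-bump-other {T} {ℓ = ℓ} {w} {p} w≢x w≢y before atz w<z D inv (inj₂ (k₀ , ℓ₀ , p₀ , s)) | no _ | yes cs≡
      with ≡just-unique (trans (cong (at T) (sym cs≡)) atz) (y-at s)
    ...   | refl = ⊥-elim (cannot-bump-swapped-y (isTableauA inv) (pendingA inv) w≢x w≢y before w<z s cs≡)
    simulate-bump-other {w = w} w≢x w≢y before atz w<z D inv (inj₂ (k₀ , ℓ₀ , p₀ , s)) | no c≢₁ | no c≢₂ =
      same-bump inv before atz w<z (Before-A⇒B-swapped s w≢x w≢y before) (trans (others s _ c≢₁ c≢₂) atz)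
                (A<⇒B< w _ w≢x w≢y w<z) (inj₂ (k₀ , ℓ₀ , p₀ , Swapped-upd s _ w c≢₁ c≢₂)) D

    simulate-bump-swapped-x : ∀ {T U ℓ w p T₁ c k₀ ℓ₀ p₀} → w ≢ x → w ≢ y →
                              A.Before T (kind w) ℓ p w → at T (cell (kind w) ℓ p) ≡ just x → κA w < κA x →
                              IA.Ins (upd T (cell (kind w) ℓ p) w) (suc (lineOf (kind x) (cell (kind w) ℓ p))) x T₁ c →
                              Invariant T U ℓ w → Swapped T U k₀ ℓ₀ p₀ → cell (kind w) ℓ p ≡ cell k₀ ℓ₀ p₀ →
                              Simulated T ℓ w T₁ c U
    simulate-bump-swapped-x {T} {U} {ℓ} {w} {p} {T₁} {c} {k₀} w≢x w≢y before atx w<x D inv s cs≡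
      with same-or-other (kind x) k₀
    ... | inj₁ refl =
      let U₁ , DB , rel = simulate D (invariant (proj₁ bumpedA) (proj₂ bumpedA) (proj₁ bumpedB₂)
                                       (subst (λ m → B.Pending (upd (upd U cs w) cx y) (kind x) m x) line-x≡ (proj₂ bumpedB₂)))
                                     (inj₁ same-result)
      in U₁ , IB.bump refl beforeB y-atU w<y-B
                (IB.bump refl before-cx x-at-cx y<x-B (subst (λ m → IB.Ins (upd (upd U cs w) cx y) m x U₁ c) (sym line-x≡) DB)) , rel
      where open WBumpsXAlong w≢x w≢y before atx w<x inv s cs≡
    ... | inj₂ refl = across D
      where
      open WBumpsXAcross w≢x w≢y before atx w<x inv s cs≡
      across : IA.Ins (upd T cs w) ℓx x T₁ c → Simulated T ℓ w T₁ c U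
      across (IA.bump refl before₃ atz₃ x<z₃ D₃) with A.scan-unique before₃ before-cy (A.blocked atz₃ x<z₃) stop-cy
      ... | refl with ≡just-unique atz₃ y-at-cy
      ...   | refl =
        let isA , pendA = A.bump-preserves (proj₁ bumpedA) (proj₂ bumpedA) before₃ atz₃ x<z₃ (kind y)
            U₁ , DB , rel = simulate D₃ (invariant isA pendA (proj₁ bumpedB)
                                          (subst (λ m → B.Pending (upd U cs w) (kind y) m y) line-y≡ (proj₂ bumpedB)))
                                        (inj₁ same-result)
        in U₁ , IB.bump refl beforeB y-atU w<y-B (subst (λ m → IB.Ins (upd U cs w) m y U₁ c) (sym line-y≡) DB) , rel
      across (IA.new refl before₃ empty₃) with A.scan-unique before₃ before-cy (A.vacant empty₃) stop-cy
      ... | refl with trans (sym empty₃) y-at-cy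
      ...   | ()

    simulate-bump-x : ∀ {T U ℓ p z T₁ c} → A.Before T (kind x) ℓ p x → at T (cell (kind x) ℓ p) ≡ just z → κA x < κA z →
                      IA.Ins (upd T (cell (kind x) ℓ p) x) (suc (lineOf (kind z) (cell (kind x) ℓ p))) z T₁ c →
                      Invariant T U ℓ x → Related T U → Simulated T ℓ x T₁ c U
    simulate-bump-x before atz x<z D inv (inj₂ (_ , _ , _ , s)) = ⊥-elim (A.fresh (pendingA inv) _ (x-at s))
    simulate-bump-x {ℓ = ℓ} {p} {z} before atz x<z D inv (inj₁ T≈U) with z ≟ y
    ... | yes refl = simulate-x-bumps-y before atz D inv T≈U
    ... | no z≢y   = same-bump inv before atz x<z (Before-A⇒B-x T≈U (A.fresh (pendingA inv)) before) (trans (T≈U _) atz)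
                               (x<⇒x<-B z z≢x z≢y x<z) (inj₁ (upd-≈ (cell (kind x) ℓ p) x T≈U)) D
      where
      z≢x : z ≢ x
      z≢x refl = A.fresh (pendingA inv) _ atz

    simulate-x-bumps-y : ∀ {T U ℓ p T₁ c} → A.Before T (kind x) ℓ p x → at T (cell (kind x) ℓ p) ≡ just y →
                         IA.Ins (upd T (cell (kind x) ℓ p) x) (suc (lineOf (kind y) (cell (kind x) ℓ p))) y T₁ c →
                         Invariant T U ℓ x → T ≈ U → Simulated T ℓ x T₁ c U
    simulate-x-bumps-y {T} {U} {ℓ} {p} {T₁} {c} before aty D inv T≈U = go D (at T cn) refl
      where
      open XBumpsY before aty inv T≈U
      go : IA.Ins (upd T cs x) ℓy y T₁ c → ∀ m → at T cn ≡ m → Simulated T ℓ x T₁ c U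
      go (IA.bump refl before₃ atz₃ y<z₃ D₃) (just e) at-cn
        with A.scan-unique before₃ before-y (A.blocked atz₃ y<z₃) (A.blocked (at-cc at-cn) (y<next at-cn))
      ... | refl with ≡just-unique atz₃ (at-cc at-cn)
      ...   | refl =
        let U₁ , DB , rel = simulate D₃ (next-invariant at-cn) (inj₂ (kind x , ℓ , p , swapped))
        in U₁ , IB.bump refl before-cnB (trans (T≈U cn) at-cn) (x<next-B at-cn)
                  (subst (λ d → IB.Ins (upd U cn x) (suc (lineOf (kind e) d)) e U₁ c) cc≡cn DB) , rel
      go (IA.bump refl before₃ atz₃ y<z₃ D₃) nothing at-cn
        with A.scan-unique before₃ before-y (A.blocked atz₃ y<z₃) (A.vacant (at-cc at-cn))
      ... | refl with trans (sym atz₃) (at-cc at-cn)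
      ...   | ()
      go (IA.new refl before₃ empty₃) (just e) at-cn
        with A.scan-unique before₃ before-y (A.vacant empty₃) (A.blocked (at-cc at-cn) (y<next at-cn))
      ... | refl with trans (sym empty₃) (at-cc at-cn)
      ...   | ()
      go (IA.new refl before₃ empty₃) nothing at-cn
        with A.scan-unique before₃ before-y (A.vacant empty₃) (A.vacant (at-cc at-cn))
      ... | refl = upd U cn x , subst (IB.Ins U ℓ x (upd U cn x)) (sym cc≡cn) (IB.new refl before-cnB (trans (T≈U cn) at-cn)) ,
                   inj₂ (kind x , ℓ , p , swapped)

    simulate-bump-y : ∀ {T U ℓ p z T₁ c} → A.Before T (kind y) ℓ p y → at T (cell (kind y) ℓ p) ≡ just z → κA y < κA z →
                      IA.Ins (upd T (cell (kind y) ℓ p) y) (suc (lineOf (kind z) (cell (kind y) ℓ p))) z T₁ c →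
                      Invariant T U ℓ y → Related T U → Simulated T ℓ y T₁ c U
    simulate-bump-y before atz y<z D inv (inj₂ (_ , _ , _ , s)) = ⊥-elim (A.fresh (pendingA inv) _ (y-at s))
    simulate-bump-y {T} {ℓ = ℓ} {p} before atz y<z D inv (inj₁ T≈U) with find-x T (kind y) ℓ p
    ... | inj₁ (q , q<p , ex) with stops-right-after-x (isTableauA inv) (A.fresh (pendingA inv)) before q<p ex
    ...   | refl = simulate-y-passes-x before ex atz y<z D inv T≈U
    simulate-bump-y {ℓ = ℓ} {p} {z} before atz y<z D inv (inj₁ T≈U) | inj₂ no-x =
      same-bump inv before atz y<z (Before-A⇒B-y T≈U (A.fresh (pendingA inv)) no-x before) (trans (T≈U _) atz)
                (y<⇒y<-B z y<z) (inj₁ (upd-≈ (cell (kind y) ℓ p) y T≈U)) D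

    simulate-y-passes-x : ∀ {T U ℓ q z T₁ c} → A.Before T (kind y) ℓ (suc q) y → at T (cell (kind y) ℓ q) ≡ just x →
                          at T (cell (kind y) ℓ (suc q)) ≡ just z → κA y < κA z →
                          IA.Ins (upd T (cell (kind y) ℓ (suc q)) y) (suc (lineOf (kind z) (cell (kind y) ℓ (suc q)))) z T₁ c →
                          Invariant T U ℓ y → T ≈ U → Simulated T ℓ y T₁ c U
    simulate-y-passes-x {ℓ = ℓ} {q} {z} {c = c} before ex atz y<z D inv T≈U =
      let U₂ , DB , rel = simulate D (next-invariant atz y<z) (inj₂ (kind y , ℓ , q , swapped))
      in U₂ , IB.bump refl before-x x-atU y<x-B
                (IB.bump refl before-cq (at-cq atz) (x<z-B atz y<z)
                  (subst (λ d → IB.Ins (upd U₁ cq x) (suc (lineOf (kind z) d)) z U₂ c) (sym cq≡cs) DB)) , rel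
      where open YPassesX before ex inv T≈U

  Related-entries : ∀ {T U} → Related T U → ∀ c a → at U c ≡ just a → Σ Cell λ d → at T d ≡ just a
  Related-entries (inj₁ T≈U) c a ea = c , trans (sym (T≈U c)) ea
  Related-entries (inj₂ (k₀ , ℓ₀ , p₀ , s)) c a ea with c ≟ᶜ cell k₀ ℓ₀ p₀ | c ≟ᶜ cell k₀ ℓ₀ (suc p₀)
  ... | yes refl | _ with ≡just-unique ea (y-at′ s)
  ...   | refl = cell k₀ ℓ₀ (suc p₀) , y-at s
  Related-entries (inj₂ (k₀ , ℓ₀ , p₀ , s)) c a ea | no _ | yes refl with ≡just-unique ea (x-at′ s)
  ...   | refl = cell k₀ ℓ₀ p₀ , x-at s
  Related-entries (inj₂ (k₀ , ℓ₀ , p₀ , s)) c a ea | no c≢₁ | no c≢₂ = c , trans (sym (others s c c≢₁ c≢₂)) ea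

  simulate-steps : ∀ {m T Q ws T₁ Q₁} → IA.Steps m T Q ws T₁ Q₁ → ∀ U → A.IsTableau T → B.IsTableau U → Related T U →
                   (∀ c a → at T c ≡ just a → All (a ≢_) ws) → Unique ws → Σ (Tab L) λ U₁ → IB.Steps m U Q ws U₁ Q₁
  simulate-steps IA.done U _ _ _ _ _ = U , IB.done
  simulate-steps {T = T} (IA.step {x = w} {xs = ws} {P₁} I S) U isT isU rel fresh (w∉ws ∷ unique) =
    let U₁ , I′ , rel₁ = simulate I (invariant isT pendA isU pendB) rel
        U₂ , S′ = simulate-steps S U₁ (IA.ins-isTableau I isT pendA) (IB.ins-isTableau I′ isU pendB) rel₁ fresh₁ unique
    in U₂ , IB.step I′ S′
    where
    freshA : A.Fresh T w
    freshA c e = All.head (fresh c w e) refl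
    pendA : A.Pending T (kind w) 0 w
    pendA = A.pending freshA 0 tt
    pendB : B.Pending U (kind w) 0 w
    pendB = B.pending (λ c e → let d , ed = Related-entries rel c w e in freshA d ed) 0 tt
    fresh₁ : ∀ c a → at P₁ c ≡ just a → All (a ≢_) ws
    fresh₁ c a ea with IA.ins-entries I c a ea
    ... | inj₁ refl     = w∉ws
    ... | inj₂ (d , ed) = All.tail (fresh d a ed)

-- Sorting the order

module _ {n : ℕ} where

  transpose-x : ∀ (x y : Fin n) → transpose x y x ≡ y
  transpose-x x y rewrite dec-true (x F.≟ x) refl = refl

  transpose-y : ∀ (x y : Fin n) → transpose x y y ≡ x
  transpose-y x y with y F.≟ x
  ... | yes refl = refl
  ... | no _ rewrite dec-true (y F.≟ y) refl = refl

  transpose-other : ∀ (x y e : Fin n) → e ≢ x → e ≢ y → transpose x y e ≡ e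
  transpose-other x y e e≢x e≢y rewrite dec-false (e F.≟ x) e≢x | dec-false (e F.≟ y) e≢y = refl

  transpose-injective : ∀ (x y a b : Fin n) → transpose x y a ≡ transpose x y b → a ≡ b
  transpose-injective x y a b e = trans (sym (transpose-inverse y x)) (trans (cong (transpose y x) e) (transpose-inverse y x))

-- Unlike a split on F._≟_, a split on this does not also rewrite the tests inside transpose.
≡-or-≢ : ∀ {n} (c d : Fin n) → (c ≡ d) ⊎ (c ≢ d)
≡-or-≢ c d with c F.≟ d
... | yes c≡d = inj₁ c≡d
... | no c≢d  = inj₂ c≢d

sumOver : ∀ {A : Set} → List A → (A → ℕ) → ℕ
sumOver []       f = 0
sumOver (a ∷ xs) f = f a + sumOver xs f

sumOver-mono-≤ : ∀ {A : Set} (xs : List A) {f g : A → ℕ} → (∀ a → f a ≤ g a) → sumOver xs f ≤ sumOver xs g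
sumOver-mono-≤ []       f≤g = z≤n
sumOver-mono-≤ (a ∷ xs) f≤g = +-mono-≤ (f≤g a) (sumOver-mono-≤ xs f≤g)

sumOver-mono-< : ∀ {A : Set} (xs : List A) {f g : A → ℕ} → (∀ a → f a ≤ g a) → ∀ {a₀} → a₀ ∈ xs → f a₀ < g a₀ →
                 sumOver xs f < sumOver xs g
sumOver-mono-< (a ∷ xs) f≤g (here refl) fa<ga = +-mono-<-≤ fa<ga (sumOver-mono-≤ xs f≤g)
sumOver-mono-< (a ∷ xs) f≤g (there a₀∈xs) fa₀<ga₀ = +-mono-≤-< (f≤g a) (sumOver-mono-< xs f≤g a₀∈xs fa₀<ga₀)

sumOver≡0 : ∀ {A : Set} (xs : List A) (f : A → ℕ) → sumOver xs f ≡ 0 → ∀ {a₀} → a₀ ∈ xs → f a₀ ≡ 0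
sumOver≡0 (a ∷ xs) f sum≡0 (here refl)   = m+n≡0⇒m≡0 (f a) sum≡0
sumOver≡0 (a ∷ xs) f sum≡0 (there a₀∈xs) = sumOver≡0 xs f (m+n≡0⇒n≡0 (f a) sum≡0) a₀∈xs

sumOver-pos : ∀ {A : Set} (xs : List A) (f : A → ℕ) → 0 < sumOver xs f → Σ A λ a → 0 < f a
sumOver-pos (a ∷ xs) f 0<sum with f a in fa≡
... | suc _ = a , subst (0 <_) (sym fa≡) z<s
... | zero  = sumOver-pos xs f 0<sum

argmin : ∀ {n} (P : Fin n → Set) → (∀ e → Dec (P e)) → (f : Fin n → ℕ) → ∀ e₀ → P e₀ →
         Σ (Fin n) λ m → P m × (∀ e → P e → f m ≤ f e)
argmin {n} P P? f e₀ pe₀ = descend (suc (f e₀)) e₀ ≤-refl pe₀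
  where
  descend : ∀ N e → f e < N → P e → Σ (Fin n) λ m → P m × (∀ e → P e → f m ≤ f e)
  descend (suc N) e fe<N pe with FP.any? (λ e′ → P? e′ ×-dec (f e′ <? f e))
  ... | yes (e′ , pe′ , fe′<fe) = descend N e′ (<-≤-trans fe′<fe (≤-pred fe<N)) pe′
  ... | no none                 = e , pe , λ e′ pe′ → ≮⇒≥ (λ fe′<fe → none (e′ , pe′ , fe′<fe))

inversion : ∀ {P : Set} → Kind → Kind → Dec P → ℕ
inversion tk uk (yes _) = 1
inversion tk uk (no _)  = 0
inversion tk tk _       = 0
inversion uk _  _       = 0

module Sorting {n : ℕ} (kind : Fin n → Kind) (κC : Fin n → ℕ) (κC-injective : ∀ a b → κC a ≡ κC b → a ≡ b)
  (u-before-t : ∀ a b → kind a ≡ uk → kind b ≡ tk → κC a < κC b) (ws : List (Fin n)) (unique : Unique ws) where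

  Recording : (Fin n → ℕ) → Tab (Fin n) → RecTableau → Set
  Recording κ T Q = GenericInsertion.Steps kind (StrictBump κ) 0 emptyTab emptyQ ws T Q

  inverted : (Fin n → ℕ) → Fin n → Fin n → ℕ
  inverted κ a b = inversion (kind a) (kind b) (κ a <? κ b)

  inversions : (Fin n → ℕ) → ℕ
  inversions κ = sumOver (allFin n) λ a → sumOver (allFin n) (inverted κ a)

  inverted-pos⇒ : ∀ κ a b → 0 < inverted κ a b → (kind a ≡ tk) × (kind b ≡ uk) × (κ a < κ b)
  inverted-pos⇒ κ a b pos with kind a | kind b | κ a <? κ b
  ... | tk | uk | yes a<b = refl , refl , a<b
  ... | tk | uk | no _    = ⊥-elim (<-irrefl refl pos)
  ... | tk | tk | _       = ⊥-elim (<-irrefl refl pos)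
  ... | uk | _  | _       = ⊥-elim (<-irrefl refl pos)

  inverted-pos : ∀ κ a b → kind a ≡ tk → kind b ≡ uk → κ a < κ b → 0 < inverted κ a b
  inverted-pos κ a b ta ub a<b with kind a | kind b | κ a <? κ b
  ... | tk | uk | yes _ = z<s
  ... | tk | uk | no a≮b = ⊥-elim (a≮b a<b)
  ... | tk | tk | _     = ⊥-elim (tk≢uk ub)
  ... | uk | _  | _     = ⊥-elim (tk≢uk (sym ta))

  inverted-mono : ∀ κ κ₂ a b → (kind a ≡ tk → kind b ≡ uk → κ₂ a < κ₂ b → κ a < κ b) → inverted κ₂ a b ≤ inverted κ a b
  inverted-mono κ κ₂ a b order with kind a | kind b | κ₂ a <? κ₂ b | κ a <? κ b
  ... | tk | uk | yes _    | yes _   = ≤-refl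
  ... | tk | uk | yes a<₂b | no a≮b  = ⊥-elim (a≮b (order refl refl a<₂b))
  ... | tk | uk | no _     | _       = z≤n
  ... | tk | tk | _        | _       = z≤n
  ... | uk | _  | _        | _       = z≤n

  inverted-≮ : ∀ κ a b → ¬ (κ a < κ b) → inverted κ a b ≡ 0
  inverted-≮ κ a b a≮b with kind a | kind b | κ a <? κ b
  ... | tk | uk | yes a<b = ⊥-elim (a≮b a<b)
  ... | tk | uk | no _    = refl
  ... | tk | tk | _       = refl
  ... | uk | _  | _       = refl

  no-inversions : ∀ κ → inversions κ ≡ 0 → ∀ a b → kind a ≡ tk → kind b ≡ uk → ¬ (κ a < κ b)
  no-inversions κ none a b ta ub a<b =
    <-irrefl (sym (sumOver≡0 (allFin n) (inverted κ a) (sumOver≡0 (allFin n) _ none (∈-allFin a)) (∈-allFin b)))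
             (inverted-pos κ a b ta ub a<b)

  AgreesWithinKinds : (Fin n → ℕ) → Set
  AgreesWithinKinds κ = ∀ a b → kind a ≡ kind b → κ a < κ b → κC a < κC b

  agrees-reflect : ∀ κ → (∀ a b → κ a ≡ κ b → a ≡ b) → AgreesWithinKinds κ →
                   ∀ a b → kind a ≡ kind b → κC a < κC b → κ a < κ b
  agrees-reflect κ κ-injective agrees a b same a<b with <-cmp (κ a) (κ b)
  ... | tri< a<b′ _ _ = a<b′
  ... | tri≈ _ a≡b _ with κ-injective a b a≡b
  ...   | refl = ⊥-elim (<-irrefl refl a<b)
  agrees-reflect κ κ-injective agrees a b same a<b | tri> _ _ b<a = ⊥-elim (<-asym a<b (agrees b a (sym same) b<a))

  sorted⇒κC : ∀ κ → AgreesWithinKinds κ → inversions κ ≡ 0 → ∀ k a b → StrictBump κ k a b → StrictBump κC k a b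
  sorted⇒κC κ agrees none k a b a<b with tk-or-uk (kind a) | tk-or-uk (kind b)
  ... | inj₁ ta | inj₁ tb = agrees a b (trans ta (sym tb)) a<b
  ... | inj₂ ua | inj₂ ub = agrees a b (trans ua (sym ub)) a<b
  ... | inj₁ ta | inj₂ ub = ⊥-elim (no-inversions κ none a b ta ub a<b)
  ... | inj₂ ua | inj₁ tb = u-before-t a b ua tb

  κC⇒sorted : ∀ κ → (∀ a b → κ a ≡ κ b → a ≡ b) → AgreesWithinKinds κ → inversions κ ≡ 0 →
              ∀ k a b → StrictBump κC k a b → StrictBump κ k a b
  κC⇒sorted κ κ-injective agrees none k a b a<b with tk-or-uk (kind a) | tk-or-uk (kind b)
  ... | inj₁ ta | inj₁ tb = agrees-reflect κ κ-injective agrees a b (trans ta (sym tb)) a<b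
  ... | inj₂ ua | inj₂ ub = agrees-reflect κ κ-injective agrees a b (trans ua (sym ub)) a<b
  ... | inj₁ ta | inj₂ ub = ⊥-elim (<-asym a<b (u-before-t b a ub ta))
  ... | inj₂ ua | inj₁ tb with <-cmp (κ a) (κ b)
  ...   | tri< a<b′ _ _ = a<b′
  ...   | tri≈ _ a≡b _ with κ-injective a b a≡b
  ...     | refl = ⊥-elim (tk≢uk (trans (sym tb) ua))
  κC⇒sorted κ κ-injective agrees none k a b a<b | inj₂ ua | inj₁ tb | tri> _ _ b<a = ⊥-elim (no-inversions κ none b a tb ua b<a)

  -- Among the u-letters above a take the lowest, y; among the t-letters below y take the highest, x.
  adjacent-inversion : ∀ κ → (∀ a b → κ a ≡ κ b → a ≡ b) → ∀ a b → kind a ≡ tk → kind b ≡ uk → κ a < κ b →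
                       Σ (Fin n) λ x → Σ (Fin n) λ y → (kind x ≡ tk) × (kind y ≡ uk) × (κ x < κ y) ×
                       (∀ e → e ≢ x → e ≢ y → (κ e < κ x) ⊎ (κ y < κ e))
  adjacent-inversion κ κ-injective a b ta ub a<b
    with argmin (λ e → (kind e ≡ uk) × (κ a < κ e)) (λ e → (kind e ≟ᴷ uk) ×-dec (κ a <? κ e)) κ b (ub , a<b)
  ... | y , (uy , a<y) , lowest
    with argmin (λ e → (kind e ≡ tk) × (κ e < κ y)) (λ e → (kind e ≟ᴷ tk) ×-dec (κ e <? κ y)) (λ e → κ y ∸ κ e) a (ta , a<y)
  ...   | x , (tx , x<y) , closest = x , y , tx , uy , x<y , between
    where
    highest : ∀ e → (kind e ≡ tk) × (κ e < κ y) → κ e ≤ κ x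
    highest e te = ≮⇒≥ λ x<e → <⇒≱ (∸-monoʳ-< x<e (<⇒≤ (proj₂ te))) (closest e te)
    a≤x : κ a ≤ κ x
    a≤x = highest a (ta , a<y)
    between : ∀ e → e ≢ x → e ≢ y → (κ e < κ x) ⊎ (κ y < κ e)
    between e e≢x e≢y with <-cmp (κ e) (κ x)
    ... | tri< e<x _ _ = inj₁ e<x
    ... | tri≈ _ e≡x _ = ⊥-elim (e≢x (κ-injective e x e≡x))
    ... | tri> _ _ x<e with <-cmp (κ e) (κ y)
    ...   | tri> _ _ y<e = inj₂ y<e
    ...   | tri≈ _ e≡y _ = ⊥-elim (e≢y (κ-injective e y e≡y))
    ...   | tri< e<y _ _ with tk-or-uk (kind e)
    ...     | inj₁ te = ⊥-elim (<⇒≱ x<e (highest e (te , e<y)))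
    ...     | inj₂ ue = ⊥-elim (<⇒≱ e<y (lowest e (ue , ≤-<-trans a≤x x<e)))

  module SwapAdjacent (κ : Fin n → ℕ) (κ-injective : ∀ a b → κ a ≡ κ b → a ≡ b) (agrees : AgreesWithinKinds κ)
                      (x y : Fin n) (tx : kind x ≡ tk) (uy : kind y ≡ uk) (x<y : κ x < κ y)
                      (between : ∀ e → e ≢ x → e ≢ y → (κ e < κ x) ⊎ (κ y < κ e)) where

    κ₂ : Fin n → ℕ
    κ₂ e = κ (transpose x y e)

    κ₂-injective : ∀ a b → κ₂ a ≡ κ₂ b → a ≡ b
    κ₂-injective a b e = transpose-injective x y a b (κ-injective _ _ e)

    κ₂-x : κ₂ x ≡ κ y
    κ₂-x = cong κ (transpose-x x y)

    κ₂-y : κ₂ y ≡ κ x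
    κ₂-y = cong κ (transpose-y x y)

    κ₂-other : ∀ e → e ≢ x → e ≢ y → κ₂ e ≡ κ e
    κ₂-other e e≢x e≢y = cong κ (transpose-other x y e e≢x e≢y)

    order-preserved : ∀ c d → ¬ ((c ≡ y) × (d ≡ x)) → κ₂ c < κ₂ d → κ c < κ d
    order-preserved c d not-yx c<d with ≡-or-≢ c x | ≡-or-≢ d x
    ... | inj₁ refl | inj₁ refl = ⊥-elim (<-irrefl refl c<d)
    ... | inj₁ refl | inj₂ d≢x with ≡-or-≢ d y
    ...   | inj₁ refl = x<y
    ...   | inj₂ d≢y  = <-trans x<y (subst₂ _<_ κ₂-x (κ₂-other d d≢x d≢y) c<d)
    order-preserved c d not-yx c<d | inj₂ c≢x | inj₁ refl with ≡-or-≢ c y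
    ...   | inj₁ refl = ⊥-elim (not-yx (refl , refl))
    ...   | inj₂ c≢y with between c c≢x c≢y
    ...     | inj₁ c<x = c<x
    ...     | inj₂ y<c = ⊥-elim (<-asym y<c (subst₂ _<_ (κ₂-other c c≢x c≢y) κ₂-x c<d))
    order-preserved c d not-yx c<d | inj₂ c≢x | inj₂ d≢x with ≡-or-≢ c y | ≡-or-≢ d y
    ... | inj₁ refl | inj₁ refl = ⊥-elim (<-irrefl refl c<d)
    ... | inj₁ refl | inj₂ d≢y with between d d≢x d≢y
    ...   | inj₁ d<x = ⊥-elim (<-asym d<x (subst₂ _<_ κ₂-y (κ₂-other d d≢x d≢y) c<d))
    ...   | inj₂ y<d = y<d
    order-preserved c d not-yx c<d | inj₂ c≢x | inj₂ d≢x | inj₂ c≢y | inj₁ refl =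
      <-trans (subst₂ _<_ (κ₂-other c c≢x c≢y) κ₂-y c<d) x<y
    order-preserved c d not-yx c<d | inj₂ c≢x | inj₂ d≢x | inj₂ c≢y | inj₂ d≢y =
      subst₂ _<_ (κ₂-other c c≢x c≢y) (κ₂-other d d≢x d≢y) c<d

    agrees₂ : AgreesWithinKinds κ₂
    agrees₂ c d same c<d =
      agrees c d same (order-preserved c d (λ { (refl , refl) → tk≢uk (trans (sym tx) (trans (sym same) uy)) }) c<d)

    fewer : inversions κ₂ < inversions κ
    fewer = sumOver-mono-< (allFin n) row≤ (∈-allFin x)
              (sumOver-mono-< (allFin n) (inverted≤ x) (∈-allFin y)
                (subst (_< inverted κ x y) (sym (inverted-≮ κ₂ x y x≮₂y)) (inverted-pos κ x y tx uy x<y)))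
      where
      inverted≤ : ∀ c d → inverted κ₂ c d ≤ inverted κ c d
      inverted≤ c d = inverted-mono κ κ₂ c d λ tc _ → order-preserved c d λ { (refl , refl) → tk≢uk (trans (sym tc) uy) }
      row≤ : ∀ c → sumOver (allFin n) (inverted κ₂ c) ≤ sumOver (allFin n) (inverted κ c)
      row≤ c = sumOver-mono-≤ (allFin n) (inverted≤ c)
      x≮₂y : ¬ (κ₂ x < κ₂ y)
      x≮₂y x<₂y = <-asym x<y (subst₂ _<_ κ₂-x κ₂-y x<₂y)

    same-recording : ∀ {T Q} → Recording κ T Q → Σ (Tab (Fin n)) λ U → Recording κ₂ U Q
    same-recording S = simulate-steps S emptyTab A.emptyTab-isTableau B.emptyTab-isTableau (inj₁ (λ _ → refl)) (λ _ _ ()) unique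
      where
      open AdjacentSwap F._≟_ kind κ κ₂ κ-injective κ₂-injective x y (trans uy (cong other (sym tx))) x<y κ₂-x κ₂-y κ₂-other between

  record FewerInversions (κ : Fin n → ℕ) : Set where
    field
      order            : Fin n → ℕ
      order-injective  : ∀ a b → order a ≡ order b → a ≡ b
      order-agrees     : AgreesWithinKinds order
      fewer-inversions : inversions order < inversions κ
      same-recording   : ∀ {T Q} → Recording κ T Q → Σ (Tab (Fin n)) λ U → Recording order U Q

  remove-inversion : ∀ κ → (∀ a b → κ a ≡ κ b → a ≡ b) → AgreesWithinKinds κ → 0 < inversions κ → FewerInversions κ
  remove-inversion κ κ-injective agrees some with sumOver-pos (allFin n) _ some
  ... | a , row-pos with sumOver-pos (allFin n) (inverted κ a) row-pos
  ...   | b , pos with inverted-pos⇒ κ a b pos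
  ...     | ta , ub , a<b with adjacent-inversion κ κ-injective a b ta ub a<b
  ...       | x , y , tx , uy , x<y , between = record
    { order = κ₂ ; order-injective = κ₂-injective ; order-agrees = agrees₂ ; fewer-inversions = fewer ; same-recording = same-recording }
    where open SwapAdjacent κ κ-injective agrees x y tx uy x<y between

  sort : ∀ N κ → (∀ a b → κ a ≡ κ b → a ≡ b) → AgreesWithinKinds κ → inversions κ < N →
         ∀ {T Q} → Recording κ T Q → Σ (Tab (Fin n)) λ U → Recording κC U Q
  sort (suc N) κ κ-injective agrees bound {T} {Q} S with inversions κ in none
  ... | zero  = T , Steps-transport kind (sorted⇒κC κ agrees none) (κC⇒sorted κ κ-injective agrees none) S
  ... | suc m = continue (remove-inversion κ κ-injective agrees (subst (0 <_) (sym none) z<s))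
    where
    open FewerInversions
    continue : FewerInversions κ → Σ (Tab (Fin n)) λ U → Recording κC U Q
    continue r = let U , S₂ = same-recording r S in
      sort N (order r) (order-injective r) (order-agrees r) (<-≤-trans (subst (inversions (order r) <_) none (fewer-inversions r)) (≤-pred bound)) S₂

-- The word and the theorem

lex-< : ∀ n a b r s → r < n → a < b → a * n + r < b * n + s
lex-< n a b r s r<n a<b = <-≤-trans (+-monoʳ-< (a * n) r<n)
  (≤-trans (≤-reflexive (+-comm (a * n) n)) (≤-trans (*-monoˡ-≤ n a<b) (m≤m+n (b * n) s)))

lex-<-inv : ∀ n a b r s → r < n → s < n → a * n + r < b * n + s → (a < b) ⊎ ((a ≡ b) × (r < s))
lex-<-inv n a b r s r<n s<n lt with <-cmp a b
... | tri< a<b _ _ = inj₁ a<b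
... | tri≈ _ refl _ = inj₂ (refl , +-cancelˡ-< (a * n) r s lt)
... | tri> _ _ b<a = ⊥-elim (<-asym lt (lex-< n b a s r s<n b<a))

lex-≡-inv : ∀ n a b r s → r < n → s < n → a * n + r ≡ b * n + s → (a ≡ b) × (r ≡ s)
lex-≡-inv n a b r s r<n s<n eq with <-cmp a b
... | tri< a<b _ _ = ⊥-elim (<-irrefl eq (lex-< n a b r s r<n a<b))
... | tri≈ _ refl _ = refl , +-cancelˡ-≡ (a * n) r s eq
... | tri> _ _ b<a = ⊥-elim (<-irrefl (sym eq) (lex-< n b a s r s<n b<a))

tieBreak : ∀ {n} → Variant → Fin n → ℕ
tieBreak regular p = toℕ p
tieBreak {n} dual p = n ∸ suc (toℕ p)

tieBreak<n : ∀ {n} v (p : Fin n) → tieBreak v p < n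
tieBreak<n regular p = FP.toℕ<n p
tieBreak<n {suc m} dual p = s≤s (m∸n≤m m (toℕ p))

Precedes⇒tieBreak< : ∀ {n} v (a b : Fin n) → Precedes v a b → tieBreak v a < tieBreak v b
Precedes⇒tieBreak< regular a b a<b = a<b
Precedes⇒tieBreak< dual    a b b<a = ∸-monoʳ-< (s≤s b<a) (FP.toℕ<n a)

tieBreak<⇒Precedes : ∀ {n} v (a b : Fin n) → tieBreak v a < tieBreak v b → Precedes v a b
tieBreak<⇒Precedes regular a b a<b = a<b
tieBreak<⇒Precedes {n} dual a b lt with <-cmp (toℕ b) (toℕ a)
... | tri< b<a _ _ = b<a
... | tri≈ _ b≡a _ = ⊥-elim (<-irrefl (cong (λ i → n ∸ suc i) (sym b≡a)) lt)
... | tri> _ _ a<b = ⊥-elim (<⇒≱ lt (∸-monoʳ-≤ n (s≤s (<⇒≤ a<b))))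

tieBreak-injective : ∀ {n} v (a b : Fin n) → tieBreak v a ≡ tieBreak v b → a ≡ b
tieBreak-injective regular a b eq = FP.toℕ-injective eq
tieBreak-injective dual    a b eq = FP.toℕ-injective (suc-injective (∸-cancelˡ-≡ (FP.toℕ<n a) (FP.toℕ<n b) eq))

kindOf : ∀ {k l} → Letter k l → Kind
kindOf (t _) = tk
kindOf (u _) = uk

variantOf : Variant → Variant → Kind → Variant
variantOf ε δ tk = ε
variantOf ε δ uk = δ

canonicalRank : ∀ {k l} → Letter k l → ℕ
canonicalRank {l = l} (t i) = l + toℕ i
canonicalRank         (u j) = toℕ j

canonicalRank-injective : ∀ {k l} (X Y : Letter k l) → canonicalRank X ≡ canonicalRank Y → X ≡ Y
canonicalRank-injective {l = l} (t i) (t j) eq = cong t (FP.toℕ-injective (+-cancelˡ-≡ l _ _ eq))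
canonicalRank-injective         (u i) (u j) eq = cong u (FP.toℕ-injective eq)
canonicalRank-injective {l = l} (t i) (u j) eq = ⊥-elim (<-irrefl (sym eq) (<-≤-trans (FP.toℕ<n j) (m≤m+n l (toℕ i))))
canonicalRank-injective {l = l} (u i) (t j) eq = ⊥-elim (<-irrefl eq (<-≤-trans (FP.toℕ<n i) (m≤m+n l (toℕ j))))

canonicalRank-u<t : ∀ {k l} (X Y : Letter k l) → kindOf X ≡ uk → kindOf Y ≡ tk → canonicalRank X < canonicalRank Y
canonicalRank-u<t {l = l} (u i) (t j) _ _ = <-≤-trans (FP.toℕ<n i) (m≤m+n l (toℕ j))

rank<⇒canonicalRank< : ∀ {k l} (A : Shuffle k l) X Y → kindOf X ≡ kindOf Y → rank A X < rank A Y →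
                       canonicalRank X < canonicalRank Y
rank<⇒canonicalRank< {l = l} A (t i) (t j) _ lt with FP.<-cmp i j
... | tri< i<j _ _ = +-monoʳ-< l i<j
... | tri≈ _ refl _ = ⊥-elim (<-irrefl refl lt)
... | tri> _ _ j<i = ⊥-elim (<-asym lt (t-increasing A j<i))
rank<⇒canonicalRank< A (u i) (u j) _ lt with FP.<-cmp i j
... | tri< i<j _ _ = i<j
... | tri≈ _ refl _ = ⊥-elim (<-irrefl refl lt)
... | tri> _ _ j<i = ⊥-elim (<-asym lt (u-increasing A j<i))

is-just-map : ∀ {A B : Set} (f : A → B) (m : Maybe A) → is-just (Maybe.map f m) ≡ is-just m
is-just-map f (just _) = refl
is-just-map f nothing  = refl

toList≡tabulate-lookup : ∀ {A : Set} {n} (v : Vec A n) → toList v ≡ List.tabulate (lookup v)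
toList≡tabulate-lookup []      = refl
toList≡tabulate-lookup (a ∷ v) = cong (a ∷_) (toList≡tabulate-lookup v)

positions-word : ∀ {A : Set} {n} (v : Vec A n) → List.map (lookup v) (allFin n) ≡ toList v
positions-word v = trans (map-tabulate id (lookup v)) (sym (toList≡tabulate-lookup v))

-- Positions of the word are keyed by a letter rank and, among copies of one letter, by the tie-break;
-- the key is injective because the tie-break is smaller than n.
module Word {k l n : ℕ} (ε δ : Variant) (v : Vec (Letter k l) n) where

  kindAt : Fin n → Kind
  kindAt p = kindOf (lookup v p)

  variant : Kind → Variant
  variant = variantOf ε δ

  tie : Fin n → ℕ
  tie p = tieBreak (variant (kindAt p)) p

  tie<n : ∀ p → tie p < n
  tie<n p = tieBreak<n (variant (kindAt p)) p

  tie-from : ∀ {a b} → lookup v a ≡ lookup v b → tie b ≡ tieBreak (variant (kindAt a)) b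
  tie-from {b = b} same = cong (λ X → tieBreak (variant (kindOf X)) b) (sym same)

  keyedBy : (Fin n → ℕ) → Fin n → ℕ
  keyedBy ρ p = ρ p * n + tie p

  keyedBy-injective : ∀ ρ → (∀ a b → ρ a ≡ ρ b → lookup v a ≡ lookup v b) → ∀ a b → keyedBy ρ a ≡ keyedBy ρ b → a ≡ b
  keyedBy-injective ρ same-letter a b eq with lex-≡-inv n (ρ a) (ρ b) (tie a) (tie b) (tie<n a) (tie<n b) eq
  ... | ρa≡ρb , tie≡ = tieBreak-injective (variant (kindAt a)) a b (trans tie≡ (tie-from (same-letter a b ρa≡ρb)))

  copies-keyed< : ∀ (f : Letter k l → ℕ) a b → lookup v a ≡ lookup v b → Precedes (variant (kindAt a)) a b →
                  keyedBy (λ p → f (lookup v p)) a < keyedBy (λ p → f (lookup v p)) b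
  copies-keyed< f a b same pr = subst (λ X → f X * n + tie a < f (lookup v b) * n + tie b) (sym same)
    (+-monoʳ-< (f (lookup v b) * n) (subst (tie a <_) (sym (tie-from same)) (Precedes⇒tieBreak< _ a b pr)))

  canonical : Fin n → ℕ
  canonical = keyedBy (λ p → canonicalRank (lookup v p))

  canonical-injective : ∀ a b → canonical a ≡ canonical b → a ≡ b
  canonical-injective = keyedBy-injective _ λ a b → canonicalRank-injective (lookup v a) (lookup v b)

  canonical-u<t : ∀ a b → kindAt a ≡ uk → kindAt b ≡ tk → canonical a < canonical b
  canonical-u<t a b ua tb = lex-< n _ _ (tie a) (tie b) (tie<n a) (canonicalRank-u<t (lookup v a) (lookup v b) ua tb)

  module Under (A : Shuffle k l) where

    ρ : Fin n → ℕ
    ρ p = rank A (lookup v p)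

    κ : Fin n → ℕ
    κ = keyedBy ρ

    same-letter : ∀ a b → ρ a ≡ ρ b → lookup v a ≡ lookup v b
    same-letter a b eq = rank-injective A eq

    ρ-kind : ∀ a b → ρ a ≡ ρ b → kindAt a ≡ kindAt b
    ρ-kind a b eq = cong kindOf (same-letter a b eq)

    κ-injective : ∀ a b → κ a ≡ κ b → a ≡ b
    κ-injective = keyedBy-injective ρ same-letter

    κ<⇒ : ∀ a b → κ a < κ b → (ρ a < ρ b) ⊎ ((ρ a ≡ ρ b) × Precedes (variant (kindAt a)) a b)
    κ<⇒ a b a<b with lex-<-inv n (ρ a) (ρ b) (tie a) (tie b) (tie<n a) (tie<n b) a<b
    ... | inj₁ ρa<ρb = inj₁ ρa<ρb
    ... | inj₂ (ρa≡ρb , tie<) =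
      inj₂ (ρa≡ρb , tieBreak<⇒Precedes (variant (kindAt a)) a b (subst (tie a <_) (tie-from (same-letter a b ρa≡ρb)) tie<))

    ⇒κ< : ∀ a b → (ρ a < ρ b) ⊎ ((ρ a ≡ ρ b) × Precedes (variant (kindAt a)) a b) → κ a < κ b
    ⇒κ< a b (inj₁ ρa<ρb) = lex-< n (ρ a) (ρ b) (tie a) (tie b) (tie<n a) ρa<ρb
    ⇒κ< a b (inj₂ (ρa≡ρb , pr)) = copies-keyed< (rank A) a b (same-letter a b ρa≡ρb) pr

    κ-agrees : ∀ a b → kindAt a ≡ kindAt b → κ a < κ b → canonical a < canonical b
    κ-agrees a b same a<b with κ<⇒ a b a<b
    ... | inj₁ ρa<ρb = lex-< n _ _ (tie a) (tie b) (tie<n a) (rank<⇒canonicalRank< A (lookup v a) (lookup v b) same ρa<ρb)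
    ... | inj₂ (ρa≡ρb , pr) = copies-keyed< canonicalRank a b (same-letter a b ρa≡ρb) pr

    open Standardization kindAt variant ρ κ κ-injective ρ-kind κ<⇒ ⇒κ< using (module R; RankedBump; Strip; Steps-standardize)
    private module I = Insertion ε δ A

    Labels : Tableau k l → Tab (Fin n) → Set
    Labels P T = ∀ c → at P c ≡ Maybe.map (lookup v) (at T c)

    label-just : ∀ {P T c Z} → Labels P T → at P c ≡ just Z → Σ (Fin n) λ z → (at T c ≡ just z) × (lookup v z ≡ Z)
    label-just {T = T} {c} labels eZ with at T c | labels c
    ... | just z  | eq = z , refl , just-injective (trans (sym eq) eZ)
    ... | nothing | eq with trans (sym eZ) eq
    ...   | ()

    label-nothing : ∀ {P T c} → Labels P T → at P c ≡ nothing → at T c ≡ nothing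
    label-nothing {T = T} {c} labels empty with at T c | labels c
    ... | nothing | _  = refl
    ... | just _  | eq with trans (sym empty) eq
    ...   | ()

    labels-upd : ∀ {P T} c w {X} → lookup v w ≡ X → Labels P T → Labels (upd P c X) (upd T c w)
    labels-upd {P} {T} c w refl labels d with d ≟ᶜ c
    ... | yes refl = trans (at-upd-≡ P c (lookup v w)) (cong (Maybe.map (lookup v)) (sym (at-upd-≡ T c w)))
    ... | no d≢c   = trans (at-upd-≢ P c _ d≢c) (trans (labels d) (cong (Maybe.map (lookup v)) (sym (at-upd-≢ T c w d≢c))))

    Bumps⇒RankBump : ∀ vr {X Y} → Bumps vr A X Y → RankBump vr (rank A X) (rank A Y)
    Bumps⇒RankBump regular b = b
    Bumps⇒RankBump dual    b = b

    RankBump⇒Bumps : ∀ vr {X Y} → RankBump vr (rank A X) (rank A Y) → Bumps vr A X Y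
    RankBump⇒Bumps regular b = b
    RankBump⇒Bumps dual    b = b

    positions-before : ∀ {P T kk ℓ p w X} → Labels P T → lookup v w ≡ X →
                       (∀ q → q < p → Σ (Letter k l) λ Y → (at P (cell kk ℓ q) ≡ just Y) × ¬ Bumps (variant kk) A X Y) →
                       R.Before T kk ℓ p w
    positions-before {T = T} {kk} labels refl before = R.mkBefore λ q q<p →
      let Y , eY , ¬bump = before q q<p
          z , ez , lz = label-just {T = T} labels eY
      in z , ez , λ b → ¬bump (subst (Bumps (variant kk) A _) lz (RankBump⇒Bumps (variant kk) b))

    positions-bump : ∀ {kk w z X Z} → lookup v w ≡ X → lookup v z ≡ Z → Bumps (variant kk) A X Z → RankedBump kk w z
    positions-bump {kk} refl refl b = Bumps⇒RankBump (variant kk) b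

    nextIndex-kind : ∀ {z Z} i j → lookup v z ≡ Z → nextIndex Z i j ≡ suc (lineOf (kindAt z) (i , j))
    nextIndex-kind {Z = t _} i j lz = cong (λ X → suc (lineOf (kindOf X) (i , j))) (sym lz)
    nextIndex-kind {Z = u _} i j lz = cong (λ X → suc (lineOf (kindOf X) (i , j))) (sym lz)

    Ins-positions : ∀ {P ℓ X P₂ c} → I.Ins P ℓ X P₂ c → ∀ T w → lookup v w ≡ X → Labels P T →
                    Σ (Tab (Fin n)) λ T₂ → R.Ins T ℓ w T₂ c × Labels P₂ T₂
    Ins-positions (I.rowBump {r = r} {j} before atZ bumps D) T w lw labels with label-just {T = T} labels atZ
    ... | z , ez , lz with Ins-positions D (upd T (r , j) w) z lz (labels-upd {T = T} (r , j) w lw labels)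
    ...   | T₂ , D′ , labels₂ = T₂ , R.bump (cong kindOf lw) (positions-before {T = T} labels lw before) ez (positions-bump lw lz bumps)
                                              (subst (λ m → R.Ins _ m z T₂ _) (nextIndex-kind r j lz) D′) , labels₂
    Ins-positions (I.rowNew {r = r} {j} before empty) T w lw labels =
      upd T (r , j) w , R.new (cong kindOf lw) (positions-before {T = T} labels lw before) (label-nothing {T = T} labels empty) ,
      labels-upd {T = T} (r , j) w lw labels
    Ins-positions (I.colBump {c = c} {i} before atZ bumps D) T w lw labels with label-just {T = T} labels atZ
    ... | z , ez , lz with Ins-positions D (upd T (i , c) w) z lz (labels-upd {T = T} (i , c) w lw labels)
    ...   | T₂ , D′ , labels₂ = T₂ , R.bump (cong kindOf lw) (positions-before {T = T} labels lw before) ez (positions-bump lw lz bumps)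
                                              (subst (λ m → R.Ins _ m z T₂ _) (nextIndex-kind i c lz) D′) , labels₂
    Ins-positions (I.colNew {c = c} {i} before empty) T w lw labels =
      upd T (i , c) w , R.new (cong kindOf lw) (positions-before {T = T} labels lw before) (label-nothing {T = T} labels empty) ,
      labels-upd {T = T} (i , c) w lw labels

    Steps-positions : ∀ {m P Q xs P₂ Q₂} → I.Steps m P Q xs P₂ Q₂ → ∀ T ws → List.map (lookup v) ws ≡ xs → Labels P T →
                      Σ (Tab (Fin n)) λ T₂ → R.Steps m T Q ws T₂ Q₂ × Labels P₂ T₂
    Steps-positions I.done T [] refl labels = T , R.done , labels
    Steps-positions (I.step I S) T (w ∷ ws) eq labels with ∷-injective eq
    ... | lw , lws with Ins-positions I T w lw labels
    ...   | T₁ , I′ , labels₁ with Steps-positions S T₁ ws lws labels₁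
    ...     | T₂ , S′ , labels₂ = T₂ , R.step I′ S′ , labels₂

    open Sorting kindAt canonical canonical-injective canonical-u<t (allFin n) (allFin⁺ n)

    recording-canonical : ∀ {P Q} → toList v ↦[ ε , δ , A ] P , Q →
                          (Σ (Tab (Fin n)) λ T → Recording canonical T Q) × SameCells P Q
    recording-canonical {P} {Q} rsk with Steps-positions rsk emptyTab (allFin n) (positions-word v) (λ _ → refl)
    ... | T , S , labels = sort (suc (inversions κ)) κ κ-injective κ-agrees ≤-refl standardized , sameCells
      where
      standardized : Recording κ T Q
      standardized = Steps-standardize S (StrictInsertion.emptyTab-isTableau κ κ-injective) (λ _ _ _ _ ()) (λ _ _ ())
                                       (tabulate⁺-< (λ i<j → i<j))
      sameCells : SameCells P Q
      sameCells c = trans (trans (cong is-just (labels c)) (is-just-map (lookup v) (at T c))) (R.steps-sameCells S (λ _ → refl) c)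

SameCells⇒SameShape : ∀ {k l} {P P′ : Tableau k l} → SameCells P P′ → SameShape P P′
SameCells⇒SameShape same i j = transfer (same (i , j)) , transfer (sym (same (i , j)))
  where
  transfer : ∀ {A : Set} {m m′ : Maybe A} → is-just m ≡ is-just m′ → IsCell m → IsCell m′
  transfer {m′ = just _}                 _  _ = isCell
  transfer {m = just _}  {m′ = nothing} () _

theorem5 : (k l : ℕ) → 0 < k + l → (n : ℕ) → 1 ≤ n →
    (v : Vec (Letter k l) n) → (A B : Shuffle k l) → (ε δ : Variant) →
    (PA : Tableau k l) (QA : RecTableau) (PB : Tableau k l) (QB : RecTableau) →
    toList v ↦[ ε , δ , A ] PA , QA → toList v ↦[ ε , δ , B ] PB , QB →
    SameShape PA PB × (∀ i j → QA i j ≡ QB i j)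
theorem5 k l _ n _ v A B ε δ PA QA PB QB rskA rskB = SameCells⇒SameShape sameCells , λ i j → cong (λ Q → Q i j) QA≡QB
  where
  open Word ε δ v
  open Sorting kindAt canonical canonical-injective canonical-u<t (allFin n) (allFin⁺ n) using (Recording)

  canonicalA : (Σ (Tab (Fin n)) λ T → Recording canonical T QA) × SameCells PA QA
  canonicalA = Under.recording-canonical A rskA

  canonicalB : (Σ (Tab (Fin n)) λ T → Recording canonical T QB) × SameCells PB QB
  canonicalB = Under.recording-canonical B rskB

  QA≡QB : QA ≡ QB
  QA≡QB = GenericInsertion.steps-deterministic kindAt (StrictBump canonical) (proj₂ (proj₁ canonicalA)) (proj₂ (proj₁ canonicalB))

  sameCells : SameCells PA PB
  sameCells c = trans (proj₂ canonicalA c) (trans (cong (λ Q → is-just (at Q c)) QA≡QB) (sym (proj₂ canonicalB c)))
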